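{- Let $\sigma$ occur in $\tau$, with $\tau$ having left and right tails with respect to $\sigma$ each of length at most $1$, and let $x$ be the sum of the lengths of the two tails; when $x=1$, assume the right tail has length $0$. Then: (1) If $x=0$, $\sigma$ is not the socle of $[\sigma,\tau]$, and $\tau$ has neither a monotone bifix pattern of length $|\sigma|+1$ nor a bifix pattern of length $|\sigma|+2$ that is monotone alternating or monotone reverse alternating, then $\mu(\sigma,\tau)=0$. (2) If $x=1$ and $\tau$ has neither a bifix pattern of length $|\sigma|+1$ nor a bifix pattern of length $|\sigma|+2$ whose suffix pattern of length $|\sigma|+1$ is monotone, then $\mu(\sigma,\tau)=0$. (3) If $x=2$ and $\tau$ does not have a bifix pattern of length $|\sigma|+2$, then $\mu(\sigma,\tau)=0$.
   Context: Permutations are of $[d]=\{1,\dots,d\}$; $|\pi|$ is the length. The standard form of a sequence of distinct integers is the permutation order isomorphic to it. An occurrence of a consecutive pattern $\sigma$ in $\tau$ is a factor of consecutive letters of $\tau$ order isomorphic to $\sigma$. Permutations are partially ordered by $\sigma\le\tau$ iff $\sigma$ occurs as a consecutive pattern in $\tau$ ($<$ means $\le$ and $\ne$); $[\sigma,\tau]=\{\rho:\sigma\le\rho\le\tau\}$; $\mu$ is the Möbius function of this poset ($\mu(x,x)=1$, $\mu(x,y)=-\sum_{x\le z<y}\mu(x,z)$ for $x<y$). If $\sigma$ occurs in $\tau=a_1\cdots a_n$, $\tau$ has a left tail of length $i$ w.r.t. $\sigma$ if $a_{i+1}$ is the leftmost letter of $\tau$ involved in any occurrence of $\sigma$, and a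 right tail of length $j$ if $a_{n-j}$ is the rightmost such letter. The prefix (resp. suffix) pattern of length $k$ of $\tau$ is the standard form of the prefix (resp. suffix) of $\tau$ of length $k$; if they coincide, this permutation is the bifix pattern of length $k$ of $\tau$. A permutation is monotone if it is $12\cdots n$ or $n\cdots21$. A permutation $b_1\cdots b_m$ is alternating if $b_1<b_2>b_3<b_4>\cdots$ and reverse alternating if $b_1>b_2<b_3>b_4<\cdots$; it is monotone (reverse) alternating if it is (reverse) alternating and the subsequences $b_1b_3b_5\cdots$ and $b_2b_4b_6\cdots$ are each monotone (e.g. $342516$ is monotone alternating). For $\tau$, let $\partial\tau,\tau\partial,\partial\tau\partial$ be the standard forms of $\tau$ with its first letter, its last letter, and both its first and last letters removed. A carrier element of $[\sigma,\tau]$ is an element $\xi\in[\sigma,\tau]$ with $\xi<\partial\tau$, $\xi<\tau\partial$, $\xi\not\le\partial\tau\partial$ (it is unique if it exists). If $[\sigma,\tau]$ has a carrier element $\xi_1$, let $\xi_2$ be the carrier element of $[\sigma,\xi_1]$ (if any), and so on; the last element $\xi'$ of this sequence (so that $[\sigma,\xi']$ has no carrier element) is the socle of $[\sigma,\tau]$. -}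

module Defs where

open import Data.Nat using (ℕ; zero; suc; _+_; _∸_; _≤_; _<_; _>_; _≤?_; _<?_; s≤s)
open import Data.Nat.Properties using (≤-trans; m≤m+n)
open import Data.Integer using (ℤ; +_; -_)
import Data.Integer as ℤ
open import Data.List using (List; []; _∷_; length; map; take; drop; filter; upTo; concatMap; deduplicate; foldr; reverse)
open import Data.List.Properties using (≡-dec)
open import Data.List.Relation.Unary.All using (All)
open import Data.List.Relation.Unary.Unique.Propositional using (Unique)
open import Data.Product using (Σ; ∃; _×_; _,_; proj₁; proj₂)
open import Data.Sum using (_⊎_)
open import Relation.Nullary using (¬_; Dec; yes; no)
open import Relation.Nullary.Decidable using (_×-dec_)
open import Relation.Binary.PropositionalEquality using (_≡_; _≢_; refl)
import Data.Nat as ℕ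

-- Permutations of [d] = {1,…,d} are represented as lists of naturals
-- (d = length of the list).

IsPerm : List ℕ → Set
IsPerm π = Unique π × All (λ a → 1 ≤ a × a ≤ length π) π

std : List ℕ → List ℕ
std l = map (λ a → suc (length (filter (_<? a) l))) l

_≟ₗ_ : (xs ys : List ℕ) → Dec (xs ≡ ys)
_≟ₗ_ = ≡-dec ℕ._≟_

-- factor of τ of length k starting at (0-based) position i
factor : List ℕ → ℕ → ℕ → List ℕ
factor τ i k = take k (drop i τ)

-- σ occurs in τ at position i (the letters a_{i+1} … a_{i+|σ|} of τ).
OccursAt : List ℕ → List ℕ → ℕ → Set
OccursAt σ τ i = (i + length σ ≤ length τ) × (std (factor τ i (length σ)) ≡ σ)

occursAt? : ∀ σ τ i → Dec (OccursAt σ τ i)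
occursAt? σ τ i = (i + length σ ≤? length τ) ×-dec (std (factor τ i (length σ)) ≟ₗ σ)

_≼_ : List ℕ → List ℕ → Set
σ ≼ τ = ∃ λ i → OccursAt σ τ i

_≺_ : List ℕ → List ℕ → Set
σ ≺ τ = σ ≼ τ × σ ≢ τ

private
  search : ∀ σ τ (n : ℕ) → (∀ i → n ≤ i → ¬ OccursAt σ τ i) → Dec (σ ≼ τ)
  search σ τ zero h = no λ { (i , p) → h i ℕ.z≤n p }
  search σ τ (suc n) h with occursAt? σ τ n
  ... | yes p = yes (n , p)
  ... | no ¬p = search σ τ n h'
    where
    h' : ∀ i → n ≤ i → ¬ OccursAt σ τ i
    h' i n≤i with i ℕ.≟ n
    ... | yes refl = ¬p
    ... | no i≢n = h i (Data.Nat.Properties.≤∧≢⇒< n≤i λ e → i≢n (Relation.Binary.PropositionalEquality.sym e))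
      where import Data.Nat.Properties
            import Relation.Binary.PropositionalEquality

_≼?_ : ∀ σ τ → Dec (σ ≼ τ)
σ ≼? τ = search σ τ (suc (length τ)) h
  where
  h : ∀ i → suc (length τ) ≤ i → ¬ OccursAt σ τ i
  h i lt (le , _) = Data.Nat.Properties.<-irrefl refl
                      (≤-trans lt (≤-trans (m≤m+n i (length σ)) le))
    where import Data.Nat.Properties

-- All distinct consecutive patterns of τ of length < |τ|
-- (for a permutation τ these are exactly the ρ with ρ < τ).
properPatterns : List ℕ → List (List ℕ)
properPatterns τ =
  deduplicate _≟ₗ_
    (concatMap (λ k → map (λ i → std (factor τ i k)) (upTo (suc (length τ ∸ k))))
               (upTo (length τ)))

sumℤ : List ℤ → ℤ
sumℤ = foldr ℤ._+_ (+ 0)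

-- μ with a fuel argument (recursion on the length of the upper element):
-- μ(σ,σ) = 1, μ(σ,τ) = - Σ_{σ ≤ z < τ} μ(σ,z) if σ < τ, and 0 otherwise.
mobiusFuel : ℕ → List ℕ → List ℕ → ℤ
mobiusFuel zero σ τ = + 0
mobiusFuel (suc n) σ τ with σ ≟ₗ τ
... | yes _ = + 1
... | no _ with σ ≼? τ
...   | no _ = + 0
...   | yes _ = - sumℤ (map (mobiusFuel n σ) (filter (σ ≼?_) (properPatterns τ)))

μ : List ℕ → List ℕ → ℤ
μ σ τ = mobiusFuel (suc (length τ)) σ τ

-- τ has a left tail of length i w.r.t. σ: the leftmost occurrence of σ
-- starts at position i (0-based), i.e. a_{i+1} is the leftmost letter
-- involved in an occurrence.
LeftTail : List ℕ → List ℕ → ℕ → Set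
LeftTail σ τ i = OccursAt σ τ i × (∀ j → OccursAt σ τ j → i ≤ j)

-- τ has a right tail of length j w.r.t. σ: the rightmost occurrence of σ
-- ends at the letter a_{n-j}.
RightTail : List ℕ → List ℕ → ℕ → Set
RightTail σ τ j = ∃ λ i → OccursAt σ τ i × (i + length σ + j ≡ length τ)
                        × (∀ i' → OccursAt σ τ i' → i' ≤ i)

prefixPat : ℕ → List ℕ → List ℕ
prefixPat k τ = std (take k τ)

suffixPat : ℕ → List ℕ → List ℕ
suffixPat k τ = std (drop (length τ ∸ k) τ)

IsBifixPat : ℕ → List ℕ → List ℕ → Set
IsBifixPat k τ β = k ≤ length τ × prefixPat k τ ≡ β × suffixPat k τ ≡ β

incPerm : ℕ → List ℕ
incPerm n = map suc (upTo n)

Monotone : List ℕ → Set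
Monotone π = π ≡ incPerm (length π) ⊎ π ≡ reverse (incPerm (length π))

data Increasing : List ℕ → Set where
  []  : Increasing []
  [_] : ∀ x → Increasing (x ∷ [])
  _∷_ : ∀ {x y ys} → x < y → Increasing (y ∷ ys) → Increasing (x ∷ y ∷ ys)

data Decreasing : List ℕ → Set where
  []  : Decreasing []
  [_] : ∀ x → Decreasing (x ∷ [])
  _∷_ : ∀ {x y ys} → x > y → Decreasing (y ∷ ys) → Decreasing (x ∷ y ∷ ys)

MonotoneSeq : List ℕ → Set
MonotoneSeq l = Increasing l ⊎ Decreasing l

data UpFirst : List ℕ → Set
data DownFirst : List ℕ → Set
data UpFirst where
  []  : UpFirst []
  [_] : ∀ x → UpFirst (x ∷ [])
  _∷_ : ∀ {x y ys} → x < y → DownFirst (y ∷ ys) → UpFirst (x ∷ y ∷ ys)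
data DownFirst where
  []  : DownFirst []
  [_] : ∀ x → DownFirst (x ∷ [])
  _∷_ : ∀ {x y ys} → x > y → UpFirst (y ∷ ys) → DownFirst (x ∷ y ∷ ys)

Alternating : List ℕ → Set
Alternating = UpFirst

ReverseAlternating : List ℕ → Set
ReverseAlternating = DownFirst

oddPart : List ℕ → List ℕ
evenPart : List ℕ → List ℕ
oddPart [] = []
oddPart (x ∷ xs) = x ∷ evenPart xs
evenPart [] = []
evenPart (x ∷ xs) = oddPart xs

MonotoneAlternating : List ℕ → Set
MonotoneAlternating b = Alternating b × MonotoneSeq (oddPart b) × MonotoneSeq (evenPart b)

MonotoneReverseAlternating : List ℕ → Set
MonotoneReverseAlternating b = ReverseAlternating b × MonotoneSeq (oddPart b) × MonotoneSeq (evenPart b)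

∂_ : List ℕ → List ℕ
∂ τ = std (drop 1 τ)

_∂ : List ℕ → List ℕ
τ ∂ = std (take (length τ ∸ 1) τ)

∂_∂ : List ℕ → List ℕ
∂ τ ∂ = std (take (length τ ∸ 2) (drop 1 τ))

Carrier : List ℕ → List ℕ → List ℕ → Set
Carrier σ τ ξ = IsPerm ξ × σ ≼ ξ × ξ ≼ τ × ξ ≺ (∂ τ) × ξ ≺ (τ ∂) × ¬ (ξ ≼ (∂ τ ∂))

-- Starting from ξ₀ = τ, pass
-- repeatedly to the carrier element ξ_{k+1} of [σ,ξ_k]; the socle is the
-- last ξ_k, i.e. the first one for which [σ,ξ_k] has no carrier element.
data IsSocle (σ : List ℕ) : List ℕ → List ℕ → Set where
  stop : ∀ {τ} → (∀ ξ → ¬ Carrier σ τ ξ) → IsSocle σ τ τ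
  next : ∀ {τ ξ ζ} → Carrier σ τ ξ → IsSocle σ ξ ζ → IsSocle σ τ ζ

-- Write |τ| = n₂ + 2 and let ξ be the longest bifix pattern of τ of length at
-- most n₂.  Every z with σ ≤ z < τ lies below ∂τ or below τ∂, and a pattern
-- common to ∂τ and τ∂ lies below ∂τ∂ or below ξ.  Inclusion–exclusion in the
-- defining recursion of μ, together with Σ_{z ∈ [σ,w]} μ(σ,z) = 0 for σ ≠ w,
-- gives the reduction μ-vanishes: μ(σ,τ) = 0 as soon as |σ| ≤ n₂, σ ≠ ∂τ∂
-- (when ∂τ ≠ τ∂), and μ(σ,ξ) = 0 whenever ξ ⋠ ∂τ∂, i.e. whenever ξ is the
-- carrier element of [σ,τ].  The hypotheses of the proposition (permutation,
-- tails, bifix patterns, socle) pass from τ to ξ, so each of the three cases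
-- follows by induction on |τ|.  The remaining short configurations,
-- |τ| ≤ |σ| + 2, are exactly those excluded by the bifix and socle
-- hypotheses: two occurrences of σ at adjacent positions force a monotone
-- window of length |σ| + 1.

module Submission where

open import Defs
open import Data.Nat using (ℕ; zero; suc; _+_; _∸_; _≤_; _<_; _≤?_; _<?_; _≟_; z≤n; s≤s; s≤s⁻¹; _⊓_)
open import Data.Nat.Properties
open import Data.Integer using (ℤ; +_; -_)
import Data.Integer as ℤ
import Data.Integer.Properties as ℤP
open import Data.List using (List; []; _∷_; length; map; take; drop; filter; reverse; upTo; applyUpTo; applyDownFrom)
import Data.List.Properties as LP
open import Data.List.Membership.Propositional using (_∈_; find; lose)
open import Data.List.Membership.Propositional.Properties
  using ( ∈-filter⁻; ∈-filter⁺; ∈-map⁺; ∈-map⁻; ∈-concatMap⁺; ∈-concatMap⁻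
        ; ∈-upTo⁺; ∈-upTo⁻; ∈-deduplicate⁺; ∈-deduplicate⁻)
open import Data.List.Membership.Propositional.Properties.WithK using (unique∧set⇒bag)
open import Data.List.Relation.Binary.BagAndSetEquality using (∼bag⇒↭)
open import Data.List.Relation.Binary.Permutation.Propositional using (↭⇒↭ₛ)
import Data.List.Relation.Binary.Permutation.Propositional.Properties as Perm
import Data.List.Relation.Unary.Unique.Propositional.Properties as Unique
open import Data.List.Relation.Unary.Unique.DecPropositional.Properties _≟ₗ_ using (deduplicate-!)
open import Function.Base using (_∘_)
open import Function.Bundles using (mk⇔)
open import Data.List.Relation.Unary.Any using (here; there)
open import Data.List.Relation.Unary.All as All using (All; []; _∷_)
import Data.List.Relation.Unary.All.Properties as AllP
import Data.List.Relation.Unary.AllPairs.Core as AllPairs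
open import Data.List.Relation.Unary.Unique.Propositional using (Unique)
open import Data.Product using (_×_; _,_; proj₁; proj₂; ∃; Σ)
open import Data.Sum using (_⊎_; inj₁; inj₂) renaming (map to map-⊎)
open import Data.Empty using (⊥-elim)
open import Relation.Nullary using (¬_; Dec; yes; no)
open import Relation.Nullary.Decidable using (_×-dec_; _⊎-dec_; ¬?)
open import Relation.Binary.Definitions using (tri<; tri≈; tri>)
open import Relation.Binary.PropositionalEquality
  using (_≡_; _≢_; refl; sym; trans; cong; cong₂; subst; setoid; module ≡-Reasoning)
open import Data.List.Relation.Binary.Permutation.Setoid.Properties (setoid ℤ) using (foldr-commMonoid)

-- The i-th letter of a list (0-based; 0 outside the list).
at : List ℕ → ℕ → ℕ
at []       _       = 0
at (x ∷ xs) zero    = x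
at (x ∷ xs) (suc i) = at xs i

rank : ℕ → List ℕ → ℕ
rank a l = length (filter (_<? a) l)

at-map : ∀ (f : ℕ → ℕ) xs i → i < length xs → at (map f xs) i ≡ f (at xs i)
at-map f (x ∷ xs) zero    _       = refl
at-map f (x ∷ xs) (suc i) (s≤s p) = at-map f xs i p

at-std : ∀ l i → i < length l → at (std l) i ≡ suc (rank (at l i) l)
at-std l = at-map (λ a → suc (rank a l)) l

length-std : ∀ l → length (std l) ≡ length l
length-std l = LP.length-map _ l

at-factor : ∀ l i k j → j < k → at (factor l i k) j ≡ at l (i + j)
at-factor l i k j p = trans (at-take (drop i l) k j p) (at-drop l i j)
  where
  at-take : ∀ xs k j → j < k → at (take k xs) j ≡ at xs j
  at-take []       zero    j       p       = refl
  at-take []       (suc k) j       p       = refl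
  at-take (x ∷ xs) (suc k) zero    p       = refl
  at-take (x ∷ xs) (suc k) (suc j) (s≤s p) = at-take xs k j p
  at-drop : ∀ xs i j → at (drop i xs) j ≡ at xs (i + j)
  at-drop xs       zero    j = refl
  at-drop []       (suc i) j = refl
  at-drop (x ∷ xs) (suc i) j = at-drop xs i j

length-factor : ∀ l i k → i + k ≤ length l → length (factor l i k) ≡ k
length-factor l i k p = begin
  length (take k (drop i l))  ≡⟨ LP.length-take k (drop i l) ⟩
  k ⊓ length (drop i l)       ≡⟨ cong (k ⊓_) (LP.length-drop i l) ⟩
  k ⊓ (length l ∸ i)          ≡⟨ m≤n⇒m⊓n≡m (subst (_≤ length l ∸ i) (m+n∸m≡n i k) (∸-monoˡ-≤ i p)) ⟩
  k                           ∎
  where open ≡-Reasoning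

list-ext : ∀ xs ys → length xs ≡ length ys → (∀ j → j < length xs → at xs j ≡ at ys j) → xs ≡ ys
list-ext []       []       e h = refl
list-ext (x ∷ xs) (y ∷ ys) e h =
  cong₂ _∷_ (h 0 (s≤s z≤n)) (list-ext xs ys (suc-injective e) λ j p → h (suc j) (s≤s p))

rank-yes : ∀ {x a} l → x < a → rank a (x ∷ l) ≡ suc (rank a l)
rank-yes {x} {a} l p = cong length (LP.filter-accept (_<? a) {x} {l} p)

rank-no : ∀ {x a} l → ¬ x < a → rank a (x ∷ l) ≡ rank a l
rank-no {x} {a} l p = cong length (LP.filter-reject (_<? a) {x} {l} p)

rank-mono : ∀ l {a b} → a ≤ b → rank a l ≤ rank b l
rank-mono [] p = z≤n
rank-mono (x ∷ l) {a} {b} p with x <? a | x <? b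
... | yes q | yes r rewrite rank-yes l q | rank-yes l r = s≤s (rank-mono l p)
... | yes q | no r  = ⊥-elim (r (<-≤-trans q p))
... | no q  | yes r rewrite rank-no l q | rank-yes l r = m≤n⇒m≤1+n (rank-mono l p)
... | no q  | no r  rewrite rank-no l q | rank-no l r = rank-mono l p

rank-strict : ∀ l i {b} → i < length l → at l i < b → rank (at l i) l < rank b l
rank-strict (x ∷ l) zero {b} p q with x <? b
... | yes r rewrite rank-no l (<-irrefl {x} refl) | rank-yes l r = s≤s (rank-mono l (<⇒≤ q))
... | no r = ⊥-elim (r q)
rank-strict (x ∷ l) (suc i) {b} (s≤s p) q with x <? at l i | x <? b
... | yes r | yes r′ rewrite rank-yes l r | rank-yes l r′ = s≤s (rank-strict l i p q)
... | yes r | no s   = ⊥-elim (s (<-trans r q))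
... | no r  | yes r′ rewrite rank-no l r | rank-yes l r′ = m≤n⇒m≤1+n (rank-strict l i p q)
... | no r  | no r′  rewrite rank-no l r | rank-no l r′ = rank-strict l i p q

rank-transport : ∀ xs ys a b → length xs ≡ length ys
  → (∀ j → j < length xs → (at xs j < a → at ys j < b) × (at ys j < b → at xs j < a))
  → rank a xs ≡ rank b ys
rank-transport []       []       a b e h = refl
rank-transport (x ∷ xs) (y ∷ ys) a b e h with x <? a | y <? b
... | yes r | yes r′ rewrite rank-yes xs r | rank-yes ys r′ = cong suc (rank-transport xs ys a b (suc-injective e) λ j p → h (suc j) (s≤s p))
... | yes r | no s   = ⊥-elim (s (proj₁ (h 0 (s≤s z≤n)) r))
... | no r  | yes s  = ⊥-elim (r (proj₂ (h 0 (s≤s z≤n)) s))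
... | no r  | no r′  rewrite rank-no xs r | rank-no ys r′ = rank-transport xs ys a b (suc-injective e) λ j p → h (suc j) (s≤s p)

record SameOrder (xs : List ℕ) (s : ℕ) (ys : List ℕ) (t k : ℕ) : Set where
  constructor sameOrder
  field compare : ∀ i j → i < k → j < k →
                    (at xs (s + i) < at xs (s + j) → at ys (t + i) < at ys (t + j)) ×
                    (at ys (t + i) < at ys (t + j) → at xs (s + i) < at xs (s + j))
open SameOrder public

SameOrder-sym : ∀ {xs s ys t k} → SameOrder xs s ys t k → SameOrder ys t xs s k
SameOrder-sym (sameOrder h) = sameOrder λ i j p q → proj₂ (h i j p q) , proj₁ (h i j p q)

SameOrder-trans : ∀ {xs s ys t zs u k} → SameOrder xs s ys t k → SameOrder ys t zs u k → SameOrder xs s zs u k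
SameOrder-trans (sameOrder h) (sameOrder g) =
  sameOrder λ i j p q → (λ r → proj₁ (g i j p q) (proj₁ (h i j p q) r)) , (λ r → proj₂ (h i j p q) (proj₂ (g i j p q) r))

SameOrder-shift : ∀ {xs s ys t k} p c → p + c ≤ k → SameOrder xs s ys t k → SameOrder xs (s + p) ys (t + p) c
SameOrder-shift {xs} {s} {ys} {t} p c le (sameOrder h) = sameOrder shifted
  where
  shifted : ∀ i j → i < c → j < c →
              (at xs (s + p + i) < at xs (s + p + j) → at ys (t + p + i) < at ys (t + p + j)) ×
              (at ys (t + p + i) < at ys (t + p + j) → at xs (s + p + i) < at xs (s + p + j))
  shifted i j qi qj rewrite +-assoc s p i | +-assoc s p j | +-assoc t p i | +-assoc t p j
    = h (p + i) (p + j) (<-≤-trans (+-monoʳ-< p qi) le) (<-≤-trans (+-monoʳ-< p qj) le)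

std-sameOrder : ∀ l → SameOrder l 0 (std l) 0 (length l)
std-sameOrder l = sameOrder compares
  where
  compares : ∀ i j → i < length l → j < length l →
               (at l i < at l j → at (std l) i < at (std l) j) ×
               (at (std l) i < at (std l) j → at l i < at l j)
  compares i j p q rewrite at-std l i p | at-std l j q =
    (λ r → s≤s (rank-strict l i p r)) ,
    (λ r → ≰⇒> λ s → <⇒≱ (s≤s⁻¹ r) (rank-mono l s))

sameOrder⇒std≡ : ∀ xs ys → length xs ≡ length ys → SameOrder xs 0 ys 0 (length xs) → std xs ≡ std ys
sameOrder⇒std≡ xs ys e (sameOrder h) = list-ext (std xs) (std ys)
  (trans (length-std xs) (trans e (sym (length-std ys))))
  λ j p → let p′ = subst (j <_) (length-std xs) p in
    trans (at-std xs j p′) (trans (cong suc (rank-transport xs ys _ _ e λ k q → h k j q p′))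
      (sym (at-std ys j (subst (j <_) e p′))))

std-idem : ∀ l → std (std l) ≡ std l
std-idem l = sameOrder⇒std≡ (std l) l (length-std l)
  (subst (λ n → SameOrder (std l) 0 l 0 n) (sym (length-std l)) (SameOrder-sym (std-sameOrder l)))

sameOrder-factor⁺ : ∀ l s k {ys t c} → c ≤ k → SameOrder (factor l s k) 0 ys t c → SameOrder l s ys t c
sameOrder-factor⁺ l s k {ys} {t} {c} le (sameOrder h) = sameOrder compares
  where
  compares : ∀ i j → i < c → j < c →
               (at l (s + i) < at l (s + j) → at ys (t + i) < at ys (t + j)) ×
               (at ys (t + i) < at ys (t + j) → at l (s + i) < at l (s + j))
  compares i j p q rewrite sym (at-factor l s k i (<-≤-trans p le)) | sym (at-factor l s k j (<-≤-trans q le)) = h i j p q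

sameOrder-factor⁻ : ∀ l s k {ys t c} → c ≤ k → SameOrder l s ys t c → SameOrder (factor l s k) 0 ys t c
sameOrder-factor⁻ l s k {ys} {t} {c} le (sameOrder h) = sameOrder compares
  where
  compares : ∀ i j → i < c → j < c →
               (at (factor l s k) i < at (factor l s k) j → at ys (t + i) < at ys (t + j)) ×
               (at ys (t + i) < at ys (t + j) → at (factor l s k) i < at (factor l s k) j)
  compares i j p q rewrite at-factor l s k i (<-≤-trans p le) | at-factor l s k j (<-≤-trans q le) = h i j p q

IsStd : List ℕ → Set
IsStd z = std z ≡ z

occurrence⇒sameOrder : ∀ {z τ p} → OccursAt z τ p → SameOrder τ p z 0 (length z)
occurrence⇒sameOrder {z} {τ} {p} (le , e) =
  sameOrder-factor⁺ τ p (length z) ≤-refl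
    (subst (λ n → SameOrder f 0 z 0 n) (length-factor τ p (length z) le)
      (subst (λ w → SameOrder f 0 w 0 (length f)) e (std-sameOrder f)))
  where f = factor τ p (length z)

sameOrder⇒occurrence : ∀ {z τ p} → IsStd z → p + length z ≤ length τ → SameOrder τ p z 0 (length z) → OccursAt z τ p
sameOrder⇒occurrence {z} {τ} {p} stdz le h = le , trans (sameOrder⇒std≡ f z lf
    (subst (λ n → SameOrder f 0 z 0 n) (sym lf) (sameOrder-factor⁻ τ p (length z) ≤-refl h))) stdz
  where f = factor τ p (length z)
        lf = length-factor τ p (length z) le

occurring⇒std : ∀ {z τ p} → OccursAt z τ p → IsStd z
occurring⇒std (le , e) = trans (cong std (sym e)) (trans (std-idem _) e)

≼⇒std : ∀ {z τ} → z ≼ τ → IsStd z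
≼⇒std (p , o) = occurring⇒std o

≼-length : ∀ {z τ} → z ≼ τ → length z ≤ length τ
≼-length {z} (p , o) = ≤-trans (m≤n+m (length z) p) (proj₁ o)

occurrence-trans : ∀ {z w τ p q} → OccursAt z w p → OccursAt w τ q → OccursAt z τ (q + p)
occurrence-trans {z} {w} {τ} {p} {q} o₁ o₂ =
  sameOrder⇒occurrence (occurring⇒std o₁) le
    (SameOrder-trans (SameOrder-shift p (length z) (proj₁ o₁) (occurrence⇒sameOrder o₂)) (occurrence⇒sameOrder o₁))
  where le : q + p + length z ≤ length τ
        le = ≤-trans (subst (_≤ q + length w) (sym (+-assoc q p (length z))) (+-monoʳ-≤ q (proj₁ o₁))) (proj₁ o₂)

≼-trans : ∀ {z w τ} → z ≼ w → w ≼ τ → z ≼ τ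
≼-trans (p , o₁) (q , o₂) = q + p , occurrence-trans o₁ o₂

≼-refl : ∀ {z} → IsStd z → z ≼ z
≼-refl {z} stdz = 0 , ≤-refl , trans (cong std (LP.take-all (length z) z ≤-refl)) stdz

≼-same-length : ∀ {z w} → IsStd w → z ≼ w → length z ≡ length w → z ≡ w
≼-same-length {z} {w} stdw (p , le , e) eq = trans (sym e) (trans (cong std whole) stdw)
  where
  p≡0 : p ≡ 0
  p≡0 = n≤0⇒n≡0 (+-cancelʳ-≤ (length z) p 0 (subst (p + length z ≤_) (sym eq) le))
  whole : factor w p (length z) ≡ w
  whole rewrite p≡0 | eq = LP.take-all (length w) w ≤-refl

module FactorPatterns (τ : List ℕ) (s k : ℕ) (sk : s + k ≤ length τ) where
  private
    f = factor τ s k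
    w = std f
    lf : length f ≡ k
    lf = length-factor τ s k sk
    lw : length w ≡ k
    lw = trans (length-std f) lf
    window : SameOrder τ s w 0 k
    window = sameOrder-factor⁺ τ s k ≤-refl (subst (λ n → SameOrder f 0 w 0 n) lf (std-sameOrder f))

  occurrence-in-factor⁻ : ∀ {z p} → OccursAt z w p → OccursAt z τ (s + p) × p + length z ≤ k
  occurrence-in-factor⁻ {z} {p} o =
    sameOrder⇒occurrence (occurring⇒std o) le
      (SameOrder-trans (SameOrder-shift p (length z) inside window) (occurrence⇒sameOrder o)) , inside
    where inside : p + length z ≤ k
          inside = subst (p + length z ≤_) lw (proj₁ o)
          le : s + p + length z ≤ length τ
          le = ≤-trans (subst (_≤ s + k) (sym (+-assoc s p (length z))) (+-monoʳ-≤ s inside)) sk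

  occurrence-in-factor⁺ : ∀ {z p} → p + length z ≤ k → OccursAt z τ (s + p) → OccursAt z w p
  occurrence-in-factor⁺ {z} {p} le o =
    sameOrder⇒occurrence (occurring⇒std o) (subst (p + length z ≤_) (sym lw) le)
      (SameOrder-trans (SameOrder-sym (SameOrder-shift p (length z) le window)) (occurrence⇒sameOrder o))

  ≼-factor⁻ : ∀ {z} → z ≼ w → Σ ℕ λ p → OccursAt z τ (s + p) × p + length z ≤ k
  ≼-factor⁻ (p , o) = p , occurrence-in-factor⁻ o

  ≼-factor⁺ : ∀ {z} p → OccursAt z τ (s + p) → p + length z ≤ k → z ≼ w
  ≼-factor⁺ p o le = p , occurrence-in-factor⁺ le o

  factor≼ : w ≼ τ
  factor≼ = s , subst (λ n → s + n ≤ length τ) (sym lw) sk , cong std (cong (factor τ s) lw)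

  length-factorPattern : length w ≡ k
  length-factorPattern = lw

open FactorPatterns public

-- Sums Σ_{z ∈ U, P z} f z over a finite list U of patterns, as in the
-- definition of μ.  They are computed via the pointwise restriction of f to P,
-- which turns inclusion–exclusion into a pointwise identity.
DecPred : (List ℕ → Set) → Set
DecPred P = ∀ z → Dec (P z)

sumOn : ∀ {P} → DecPred P → List (List ℕ) → (List ℕ → ℤ) → ℤ
sumOn P? U f = sumℤ (map f (filter P? U))

total : List (List ℕ) → (List ℕ → ℤ) → ℤ
total U g = sumℤ (map g U)

weight : ∀ {P : Set} → Dec P → ℤ → ℤ
weight (yes _) x = x
weight (no _)  _ = + 0

restrict : ∀ {P} → DecPred P → (List ℕ → ℤ) → List ℕ → ℤ
restrict P? f z = weight (P? z) (f z)

sumOn-restrict : ∀ {P} (P? : DecPred P) U f → sumOn P? U f ≡ total U (restrict P? f)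
sumOn-restrict P? [] f = refl
sumOn-restrict P? (x ∷ U) f with P? x
... | yes _ = cong (λ t → f x ℤ.+ t) (sumOn-restrict P? U f)
... | no _  = trans (sumOn-restrict P? U f) (sym (ℤP.+-identityˡ _))

total-cong : ∀ U {g h} → (∀ z → z ∈ U → g z ≡ h z) → total U g ≡ total U h
total-cong []      e = refl
total-cong (x ∷ U) e = cong₂ ℤ._+_ (e x (here refl)) (total-cong U λ z m → e z (there m))

total-+ : ∀ U g h → total U (λ z → g z ℤ.+ h z) ≡ total U g ℤ.+ total U h
total-+ []      g h = refl
total-+ (x ∷ U) g h = begin
  (g x ℤ.+ h x) ℤ.+ total U (λ z → g z ℤ.+ h z)  ≡⟨ cong (λ t → (g x ℤ.+ h x) ℤ.+ t) (total-+ U g h) ⟩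
  (g x ℤ.+ h x) ℤ.+ (total U g ℤ.+ total U h)     ≡⟨ ℤP.+-assoc (g x) (h x) _ ⟩
  g x ℤ.+ (h x ℤ.+ (total U g ℤ.+ total U h))     ≡⟨ cong (λ t → g x ℤ.+ t) (ℤP.+-comm (h x) _) ⟩
  g x ℤ.+ ((total U g ℤ.+ total U h) ℤ.+ h x)     ≡⟨ cong (λ t → g x ℤ.+ t) (ℤP.+-assoc (total U g) _ _) ⟩
  g x ℤ.+ (total U g ℤ.+ (total U h ℤ.+ h x))     ≡⟨ cong (λ t → g x ℤ.+ (total U g ℤ.+ t)) (ℤP.+-comm _ (h x)) ⟩
  g x ℤ.+ (total U g ℤ.+ (h x ℤ.+ total U h))     ≡⟨ ℤP.+-assoc (g x) _ _ ⟨
  (g x ℤ.+ total U g) ℤ.+ (h x ℤ.+ total U h)     ∎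
  where open ≡-Reasoning

sumOn-cong : ∀ {P Q} (P? : DecPred P) (Q? : DecPred Q) U f
  → (∀ z → z ∈ U → P z → Q z) → (∀ z → z ∈ U → Q z → P z) → sumOn P? U f ≡ sumOn Q? U f
sumOn-cong {P} {Q} P? Q? U f pq qp =
  trans (sumOn-restrict P? U f) (trans (total-cong U same) (sym (sumOn-restrict Q? U f)))
  where
  same : ∀ z → z ∈ U → restrict P? f z ≡ restrict Q? f z
  same z m with P? z | Q? z
  ... | yes _ | yes _ = refl
  ... | yes p | no q  = ⊥-elim (q (pq z m p))
  ... | no p  | yes q = ⊥-elim (p (qp z m q))
  ... | no _  | no _  = refl

sumOn-zero : ∀ {P} (P? : DecPred P) U f → (∀ z → z ∈ U → P z → f z ≡ + 0) → sumOn P? U f ≡ + 0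
sumOn-zero P? U f h = trans (sumOn-restrict P? U f) (trans (total-cong U vanish) (total-zero U))
  where
  vanish : ∀ z → z ∈ U → restrict P? f z ≡ + 0
  vanish z m with P? z
  ... | yes p = h z m p
  ... | no _  = refl
  total-zero : ∀ U → total U (λ _ → + 0) ≡ + 0
  total-zero []      = refl
  total-zero (_ ∷ U) = trans (ℤP.+-identityˡ _) (total-zero U)

sumOn-union : ∀ {P Q} (P? : DecPred P) (Q? : DecPred Q) U f →
  sumOn (λ z → P? z ⊎-dec Q? z) U f ℤ.+ sumOn (λ z → P? z ×-dec Q? z) U f ≡ sumOn P? U f ℤ.+ sumOn Q? U f
sumOn-union P? Q? U f = begin
  sumOn P∪Q? U f ℤ.+ sumOn P∩Q? U f
    ≡⟨ cong₂ ℤ._+_ (sumOn-restrict P∪Q? U f) (sumOn-restrict P∩Q? U f) ⟩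
  total U (restrict P∪Q? f) ℤ.+ total U (restrict P∩Q? f)
    ≡⟨ total-+ U _ _ ⟨
  total U (λ z → restrict P∪Q? f z ℤ.+ restrict P∩Q? f z)
    ≡⟨ total-cong U (λ z _ → pointwise z) ⟩
  total U (λ z → restrict P? f z ℤ.+ restrict Q? f z)
    ≡⟨ total-+ U _ _ ⟩
  total U (restrict P? f) ℤ.+ total U (restrict Q? f)
    ≡⟨ cong₂ ℤ._+_ (sumOn-restrict P? U f) (sumOn-restrict Q? U f) ⟨
  sumOn P? U f ℤ.+ sumOn Q? U f ∎
  where
  open ≡-Reasoning
  P∪Q? = λ z → P? z ⊎-dec Q? z
  P∩Q? = λ z → P? z ×-dec Q? z
  pointwise : ∀ z → restrict P∪Q? f z ℤ.+ restrict P∩Q? f z ≡ restrict P? f z ℤ.+ restrict Q? f z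
  pointwise z with P? z | Q? z
  ... | yes _ | yes _ = refl
  ... | yes _ | no _  = refl
  ... | no _  | yes _ = ℤP.+-comm (f z) (+ 0)
  ... | no _  | no _  = refl

sumOn-split : ∀ {P Q} (P? : DecPred P) (Q? : DecPred Q) U f →
  sumOn P? U f ≡ sumOn (λ z → P? z ×-dec Q? z) U f ℤ.+ sumOn (λ z → P? z ×-dec ¬? (Q? z)) U f
sumOn-split P? Q? U f = begin
  sumOn P? U f
    ≡⟨ sumOn-restrict P? U f ⟩
  total U (restrict P? f)
    ≡⟨ total-cong U (λ z _ → pointwise z) ⟩
  total U (λ z → restrict P∩Q? f z ℤ.+ restrict P∖Q? f z)
    ≡⟨ total-+ U _ _ ⟩
  total U (restrict P∩Q? f) ℤ.+ total U (restrict P∖Q? f)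
    ≡⟨ cong₂ ℤ._+_ (sumOn-restrict P∩Q? U f) (sumOn-restrict P∖Q? U f) ⟨
  sumOn P∩Q? U f ℤ.+ sumOn P∖Q? U f ∎
  where
  open ≡-Reasoning
  P∩Q? = λ z → P? z ×-dec Q? z
  P∖Q? = λ z → P? z ×-dec ¬? (Q? z)
  pointwise : ∀ z → restrict P? f z ≡ restrict P∩Q? f z ℤ.+ restrict P∖Q? f z
  pointwise z with P? z | Q? z
  ... | yes _ | yes _ = sym (ℤP.+-identityʳ (f z))
  ... | yes _ | no _  = sym (ℤP.+-identityˡ (f z))
  ... | no _  | yes _ = refl
  ... | no _  | no _  = refl

sum-sameSet : ∀ (f : List ℕ → ℤ) {xs ys : List (List ℕ)} → Unique xs → Unique ys
  → (∀ z → z ∈ xs → z ∈ ys) → (∀ z → z ∈ ys → z ∈ xs) → sumℤ (map f xs) ≡ sumℤ (map f ys)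
sum-sameSet f ux uy h g =
  foldr-commMonoid ℤP.+-0-isCommutativeMonoid
    (↭⇒↭ₛ (Perm.map⁺ f (∼bag⇒↭ (unique∧set⇒bag ux uy (λ {z} → mk⇔ (h z) (g z))))))

properPattern⁻ : ∀ {z τ} → z ∈ properPatterns τ → z ≼ τ × length z < length τ
properPattern⁻ {z} {τ} m =
  subst (λ y → y ≼ τ × length y < length τ) (sym pattern≡)
    (factor≼ τ i k fits , subst (_< n) (sym (length-factorPattern τ i k fits)) k<n)
  where
  n = length τ
  windows = λ k → map (λ i → std (factor τ i k)) (upTo (suc (n ∸ k)))
  byLength = find (∈-concatMap⁻ windows {xs = upTo n} (∈-deduplicate⁻ _≟ₗ_ _ m))
  k = proj₁ byLength
  k<n : k < n
  k<n = ∈-upTo⁻ (proj₁ (proj₂ byLength))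
  byStart = ∈-map⁻ (λ i → std (factor τ i k)) (proj₂ (proj₂ byLength))
  i = proj₁ byStart
  fits : i + k ≤ n
  fits = subst (_≤ n) (+-comm k i)
           (subst (k + i ≤_) (m+[n∸m]≡n (<⇒≤ k<n)) (+-monoʳ-≤ k (≤-pred (∈-upTo⁻ (proj₁ (proj₂ byStart))))))
  pattern≡ : z ≡ std (factor τ i k)
  pattern≡ = proj₂ (proj₂ byStart)

properPattern⁺ : ∀ {z τ} → z ≼ τ → length z < length τ → z ∈ properPatterns τ
properPattern⁺ {z} {τ} (i , le , e) lt =
  ∈-deduplicate⁺ _≟ₗ_ (∈-concatMap⁺ windows {xs = upTo (length τ)} (lose (∈-upTo⁺ lt) atLength))
  where
  windows = λ k → map (λ i → std (factor τ i k)) (upTo (suc (length τ ∸ k)))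
  atLength : z ∈ windows (length z)
  atLength = subst (_∈ windows (length z)) e
               (∈-map⁺ (λ i → std (factor τ i (length z))) (∈-upTo⁺ (s≤s (m+n≤o⇒m≤o∸n i le))))

properPatterns-unique : ∀ τ → Unique (properPatterns τ)
properPatterns-unique τ = deduplicate-! _

mobiusFuel-stable : ∀ σ n₁ n₂ z → length z < n₁ → length z < n₂ → mobiusFuel n₁ σ z ≡ mobiusFuel n₂ σ z
mobiusFuel-stable σ (suc n₁) (suc n₂) z p q with σ ≟ₗ z
... | yes _ = refl
... | no _ with σ ≼? z
...   | no _  = refl
...   | yes _ = cong -_ (cong sumℤ (LP.map-cong-local {xs = filter (σ ≼?_) (properPatterns z)} (All.tabulate λ {w} m →
          let lw = proj₂ (properPattern⁻ {w} {z} (proj₁ (∈-filter⁻ (σ ≼?_) {xs = properPatterns z} m))) in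
          mobiusFuel-stable σ n₁ n₂ w (<-≤-trans lw (≤-pred p)) (<-≤-trans lw (≤-pred q)))))

μ-unfold : ∀ {σ τ} → σ ≢ τ → σ ≼ τ → μ σ τ ≡ - sumOn (σ ≼?_) (properPatterns τ) (μ σ)
μ-unfold {σ} {τ} ne le with σ ≟ₗ τ
... | yes e = ⊥-elim (ne e)
... | no _ with σ ≼? τ
...   | no nle = ⊥-elim (nle le)
...   | yes _ = cong -_ (cong sumℤ (LP.map-cong-local {xs = filter (σ ≼?_) (properPatterns τ)} (All.tabulate λ {w} m →
          let lw = proj₂ (properPattern⁻ {w} {τ} (proj₁ (∈-filter⁻ (σ ≼?_) {xs = properPatterns τ} m))) in
          mobiusFuel-stable σ (length τ) (suc (length w)) w lw ≤-refl)))

μ-self : ∀ σ → μ σ σ ≡ + 1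
μ-self σ with σ ≟ₗ σ
... | yes _ = refl
... | no ne = ⊥-elim (ne refl)

InInterval : List ℕ → List ℕ → List ℕ → Set
InInterval σ w z = σ ≼ z × z ≼ w

inInterval? : ∀ σ w → DecPred (InInterval σ w)
inInterval? σ w z = (σ ≼? z) ×-dec (z ≼? w)

-- Σ_{z ∈ [σ,w]} μ(σ,z) = 0 for σ ≠ w, computed inside the proper patterns of
-- any τ of which w is a proper pattern.
interval-sum-vanishes : ∀ σ τ w → w ≼ τ → length w < length τ → σ ≢ w →
  sumOn (inInterval? σ w) (properPatterns τ) (μ σ) ≡ + 0
interval-sum-vanishes σ τ w wτ lw ne with σ ≼? w
... | no σ⋠w = sumOn-zero (inInterval? σ w) (properPatterns τ) (μ σ) λ z _ r → ⊥-elim (σ⋠w (≼-trans (proj₁ r) (proj₂ r)))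
... | yes σw = begin
  sumOn I? U (μ σ)                                      ≡⟨ sumOn-split I? shorter? U (μ σ) ⟩
  sumOn (λ z → I? z ×-dec shorter? z) U (μ σ) ℤ.+
    sumOn (λ z → I? z ×-dec ¬? (shorter? z)) U (μ σ)    ≡⟨ cong₂ ℤ._+_ below top ⟩
  S ℤ.+ μ σ w                                           ≡⟨ cong (λ t → S ℤ.+ t) (μ-unfold ne σw) ⟩
  S ℤ.+ - S                                             ≡⟨ ℤP.+-inverseʳ S ⟩
  + 0                                                   ∎
  where
  open ≡-Reasoning
  U = properPatterns τ
  I? = inInterval? σ w
  shorter? = λ (z : List ℕ) → length z <? length w
  S = sumOn (σ ≼?_) (properPatterns w) (μ σ)
  -- the part of the interval below w is summed in the recursion for μ(σ,w)
  below : sumOn (λ z → I? z ×-dec shorter? z) U (μ σ) ≡ S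
  below = sum-sameSet (μ σ) (Unique.filter⁺ _ (properPatterns-unique τ)) (Unique.filter⁺ _ (properPatterns-unique w))
    (λ z m → let (_ , (a , b) , c) = ∈-filter⁻ (λ z → I? z ×-dec shorter? z) {xs = U} m in
       ∈-filter⁺ (σ ≼?_) (properPattern⁺ b c) a)
    (λ z m → let (m′ , a) = ∈-filter⁻ (σ ≼?_) {xs = properPatterns w} m ; (b , c) = properPattern⁻ m′ in
       ∈-filter⁺ (λ z → I? z ×-dec shorter? z) (properPattern⁺ (≼-trans b wτ) (<-trans c lw)) ((a , b) , c))
  -- the only element of the interval of full length is w itself
  top : sumOn (λ z → I? z ×-dec ¬? (shorter? z)) U (μ σ) ≡ μ σ w
  top = trans (sum-sameSet (μ σ) {ys = w ∷ []} (Unique.filter⁺ _ (properPatterns-unique τ)) (All.[] AllPairs.∷ AllPairs.[])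
    (λ z m → let (_ , (a , b) , c) = ∈-filter⁻ (λ z → I? z ×-dec ¬? (shorter? z)) {xs = U} m in
       here (≼-same-length (≼⇒std wτ) b (≤-antisym (≼-length b) (≮⇒≥ c))))
    (λ { z (here refl) → ∈-filter⁺ (λ z → I? z ×-dec ¬? (shorter? z)) (properPattern⁺ wτ lw)
                                   ((σw , ≼-refl (≼⇒std wτ)) , <-irrefl refl) }))
    (ℤP.+-identityʳ (μ σ w))

suffixPat≡ : ∀ τ k → k ≤ length τ → suffixPat k τ ≡ std (factor τ (length τ ∸ k) k)
suffixPat≡ τ k le = cong std (sym (LP.take-all k (drop (length τ ∸ k) τ)
  (≤-reflexive (trans (LP.length-drop (length τ ∸ k) τ) (m∸[m∸n]≡n le)))))

HasBifix : List ℕ → ℕ → Set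
HasBifix τ k = prefixPat k τ ≡ suffixPat k τ

maxBifixBelow : List ℕ → ℕ → ℕ
maxBifixBelow τ zero = zero
maxBifixBelow τ (suc k) with prefixPat (suc k) τ ≟ₗ suffixPat (suc k) τ
... | yes _ = suc k
... | no _  = maxBifixBelow τ k

maxBifixBelow-≤ : ∀ τ k → maxBifixBelow τ k ≤ k
maxBifixBelow-≤ τ zero = z≤n
maxBifixBelow-≤ τ (suc k) with prefixPat (suc k) τ ≟ₗ suffixPat (suc k) τ
... | yes _ = ≤-refl
... | no _  = m≤n⇒m≤1+n (maxBifixBelow-≤ τ k)

maxBifixBelow-bifix : ∀ τ k → HasBifix τ (maxBifixBelow τ k)
maxBifixBelow-bifix τ zero = cong std (sym (LP.drop-all (length τ) τ ≤-refl))
maxBifixBelow-bifix τ (suc k) with prefixPat (suc k) τ ≟ₗ suffixPat (suc k) τ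
... | yes e = e
... | no _  = maxBifixBelow-bifix τ k

maxBifixBelow-max : ∀ τ k j → j ≤ k → HasBifix τ j → j ≤ maxBifixBelow τ k
maxBifixBelow-max τ zero j le _ = le
maxBifixBelow-max τ (suc k) j le b with prefixPat (suc k) τ ≟ₗ suffixPat (suc k) τ
... | yes _ = le
... | no ne with j ≟ suc k
...   | yes refl = ⊥-elim (ne b)
...   | no j≢ = maxBifixBelow-max τ k j (s≤s⁻¹ (≤∧≢⇒< le j≢)) b

-- ξ(τ): the longest bifix pattern of τ of length at most |τ| − 2.  It is the
-- candidate carrier element of [σ,τ] (common patterns of ∂τ and τ∂ that are
-- not below ∂τ∂ are exactly those below ξ).
maxBifixLength : List ℕ → ℕ
maxBifixLength τ = maxBifixBelow τ (length τ ∸ 2)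

maxBifix : List ℕ → List ℕ
maxBifix τ = prefixPat (maxBifixLength τ) τ

-- The pieces of τ, |τ| = n₂ + 2, seen as factors: ∂τ = τ[1, n₂+2), τ∂ = τ[0, n₂+1),
-- ∂τ∂ = τ[1, n₂+1), and ξ = maxBifix τ, both the prefix τ[0,K) and the suffix
-- τ[c,c+K) pattern, where K = |ξ| ≤ n₂ and c = n₂ + 2 − K ≥ 2.
module Ends (τ : List ℕ) (n₂ : ℕ) (|τ|≡ : length τ ≡ suc (suc n₂)) where
  K = maxBifixLength τ
  ξ = maxBifix τ
  c = suc (suc (n₂ ∸ K))
  ∂τ τ∂ ∂τ∂ : List ℕ
  ∂τ = ∂ τ
  τ∂ = τ ∂
  ∂τ∂ = ∂ τ ∂

  K≤n₂ : K ≤ n₂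
  K≤n₂ = subst (λ k → maxBifixBelow τ (k ∸ 2) ≤ n₂) (sym |τ|≡) (maxBifixBelow-≤ τ n₂)

  c+K≡ : c + K ≡ length τ
  c+K≡ = trans (cong (λ t → suc (suc t)) (m∸n+n≡m K≤n₂)) (sym |τ|≡)

  fits∂τ : 1 + suc n₂ ≤ length τ
  fits∂τ = ≤-reflexive (sym |τ|≡)
  fitsτ∂ : 0 + suc n₂ ≤ length τ
  fitsτ∂ = subst (suc n₂ ≤_) (sym |τ|≡) (n≤1+n _)
  fits∂τ∂ : 1 + n₂ ≤ length τ
  fits∂τ∂ = subst (suc n₂ ≤_) (sym |τ|≡) (n≤1+n _)
  fitsPrefix : 0 + K ≤ length τ
  fitsPrefix = subst (K ≤_) (sym |τ|≡) (m≤n⇒m≤1+n (m≤n⇒m≤1+n K≤n₂))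
  fitsSuffix : c + K ≤ length τ
  fitsSuffix = ≤-reflexive c+K≡

  ∂τ≡ : ∂τ ≡ std (factor τ 1 (suc n₂))
  ∂τ≡ = cong std (sym (LP.take-all (suc n₂) (drop 1 τ) (≤-reflexive (trans (LP.length-drop 1 τ) (cong (_∸ 1) |τ|≡)))))

  τ∂≡ : τ∂ ≡ std (factor τ 0 (suc n₂))
  τ∂≡ = cong (λ k → std (take (k ∸ 1) τ)) |τ|≡

  ∂τ∂≡ : ∂τ∂ ≡ std (factor τ 1 n₂)
  ∂τ∂≡ = cong (λ k → std (take (k ∸ 2) (drop 1 τ))) |τ|≡

  ξ≡suffix : ξ ≡ std (factor τ c K)
  ξ≡suffix = trans (maxBifixBelow-bifix τ (length τ ∸ 2)) (trans (suffixPat≡ τ K fitsPrefix)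
               (cong (λ s → std (factor τ s K)) (+-cancelʳ-≡ K _ _ (trans (m∸n+n≡m fitsPrefix) (sym c+K≡)))))

  ∂τ≼τ : ∂τ ≼ τ
  ∂τ≼τ = subst (_≼ τ) (sym ∂τ≡) (factor≼ τ 1 (suc n₂) fits∂τ)
  τ∂≼τ : τ∂ ≼ τ
  τ∂≼τ = subst (_≼ τ) (sym τ∂≡) (factor≼ τ 0 (suc n₂) fitsτ∂)
  ∂τ∂≼τ : ∂τ∂ ≼ τ
  ∂τ∂≼τ = subst (_≼ τ) (sym ∂τ∂≡) (factor≼ τ 1 n₂ fits∂τ∂)
  ξ≼τ : ξ ≼ τ
  ξ≼τ = factor≼ τ 0 K fitsPrefix

  |∂τ| : length (∂τ) ≡ suc n₂
  |∂τ| = trans (cong length ∂τ≡) (length-factorPattern τ 1 (suc n₂) fits∂τ)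
  |τ∂| : length (τ∂) ≡ suc n₂
  |τ∂| = trans (cong length τ∂≡) (length-factorPattern τ 0 (suc n₂) fitsτ∂)
  |∂τ∂| : length (∂τ∂) ≡ n₂
  |∂τ∂| = trans (cong length ∂τ∂≡) (length-factorPattern τ 1 n₂ fits∂τ∂)
  |ξ| : length ξ ≡ K
  |ξ| = length-factorPattern τ 0 K fitsPrefix

  ∂τ∂-occurrence : OccursAt ∂τ∂ τ 1
  ∂τ∂-occurrence = subst (λ t → 1 + t ≤ length τ) (sym |∂τ∂|) fits∂τ∂ ,
                   trans (cong (std ∘ factor τ 1) |∂τ∂|) (sym ∂τ∂≡)

  |ξ|≤n₂ : length ξ ≤ n₂
  |ξ|≤n₂ = subst (_≤ n₂) (sym |ξ|) K≤n₂

  -- ξ is shorter than τ, which makes induction on |τ| possible.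
  ξ-below-bound : ∀ {N} → length τ < suc N → length ξ < N
  ξ-below-bound |τ|≤N = <-≤-trans (s≤s (m≤n⇒m≤1+n |ξ|≤n₂)) (subst (_≤ _) |τ|≡ (s≤s⁻¹ |τ|≤N))

  ≼∂τ⁺ : ∀ {z} p → OccursAt z τ (1 + p) → p + length z ≤ suc n₂ → z ≼ ∂τ
  ≼∂τ⁺ {z} p o le = subst (z ≼_) (sym ∂τ≡) (≼-factor⁺ τ 1 (suc n₂) fits∂τ p o le)
  ≼∂τ⁻ : ∀ {z} → z ≼ ∂τ → Σ ℕ λ p → OccursAt z τ (1 + p) × p + length z ≤ suc n₂
  ≼∂τ⁻ {z} h = ≼-factor⁻ τ 1 (suc n₂) fits∂τ (subst (z ≼_) ∂τ≡ h)
  ≼τ∂⁺ : ∀ {z} p → OccursAt z τ p → p + length z ≤ suc n₂ → z ≼ τ∂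
  ≼τ∂⁺ {z} p o le = subst (z ≼_) (sym τ∂≡) (≼-factor⁺ τ 0 (suc n₂) fitsτ∂ p o le)
  ≼τ∂⁻ : ∀ {z} → z ≼ τ∂ → Σ ℕ λ p → OccursAt z τ p × p + length z ≤ suc n₂
  ≼τ∂⁻ {z} h = ≼-factor⁻ τ 0 (suc n₂) fitsτ∂ (subst (z ≼_) τ∂≡ h)
  ≼∂τ∂⁺ : ∀ {z} p → OccursAt z τ (1 + p) → p + length z ≤ n₂ → z ≼ ∂τ∂
  ≼∂τ∂⁺ {z} p o le = subst (z ≼_) (sym ∂τ∂≡) (≼-factor⁺ τ 1 n₂ fits∂τ∂ p o le)
  ≼∂τ∂⁻ : ∀ {z} → z ≼ ∂τ∂ → Σ ℕ λ p → OccursAt z τ (1 + p) × p + length z ≤ n₂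
  ≼∂τ∂⁻ {z} h = ≼-factor⁻ τ 1 n₂ fits∂τ∂ (subst (z ≼_) ∂τ∂≡ h)

  ξ-prefix⁻ : ∀ {z p} → OccursAt z ξ p → OccursAt z τ p × p + length z ≤ K
  ξ-prefix⁻ = occurrence-in-factor⁻ τ 0 K fitsPrefix
  ξ-prefix⁺ : ∀ {z p} → p + length z ≤ K → OccursAt z τ p → OccursAt z ξ p
  ξ-prefix⁺ = occurrence-in-factor⁺ τ 0 K fitsPrefix
  ξ-suffix⁻ : ∀ {z p} → OccursAt z ξ p → OccursAt z τ (c + p) × p + length z ≤ K
  ξ-suffix⁻ {z} {p} o = occurrence-in-factor⁻ τ c K fitsSuffix (subst (λ w → OccursAt z w p) ξ≡suffix o)
  ξ-suffix⁺ : ∀ {z p} → p + length z ≤ K → OccursAt z τ (c + p) → OccursAt z ξ p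
  ξ-suffix⁺ {z} {p} le o = subst (λ w → OccursAt z w p) (sym ξ≡suffix) (occurrence-in-factor⁺ τ c K fitsSuffix le o)

  proper⇒≼end : ∀ {z} → z ∈ properPatterns τ → z ≼ ∂τ ⊎ z ≼ τ∂
  proper⇒≼end {z} m with properPattern⁻ {z} {τ} m
  ... | (zero , o) , lt = inj₂ (≼τ∂⁺ 0 o (s≤s⁻¹ (subst (suc (length z) ≤_) |τ|≡ lt)))
  ... | (suc p , o) , lt = inj₁ (≼∂τ⁺ p o (s≤s⁻¹ (subst (suc p + length z ≤_) |τ|≡ (proj₁ o))))

  -- A common pattern of ∂τ and τ∂ lies below ∂τ∂ or is a bifix pattern of
  -- length ≤ n₂, hence lies below ξ (unless ∂τ = τ∂ is the pattern itself).
  ≼both⇒≼∂τ∂⊎≼ξ : ∀ {z} → ∂τ ≢ τ∂ → z ≼ ∂τ → z ≼ τ∂ → z ≼ ∂τ∂ ⊎ z ≼ ξ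
  ≼both⇒≼∂τ∂⊎≼ξ {z} ne ha hb with ≼∂τ⁻ ha | ≼τ∂⁻ hb
  ... | p , oa , la | q , ob , lb with p + length z ≤? n₂
  ...   | yes le = inj₁ (≼∂τ∂⁺ p oa le)
  ...   | no gt with q
  ...     | suc q′ = inj₁ (≼∂τ∂⁺ q′ ob (s≤s⁻¹ lb))
  ...     | zero with length z ≤? n₂
  ...       | yes zl = inj₂ (≼-factor⁺ τ 0 K fitsPrefix 0 ob zK)
    where
    -- z occurs at the very start and at the very end of τ
    p+|z| : p + length z ≡ suc n₂
    p+|z| = ≤-antisym la (≰⇒> gt)
    start : length τ ∸ length z ≡ 1 + p
    start = trans (cong (_∸ length z) (trans |τ|≡ (cong suc (sym p+|z|)))) (m+n∸n≡m (suc p) (length z))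
    bifix : HasBifix τ (length z)
    bifix = trans (proj₂ ob) (sym (trans (suffixPat≡ τ (length z) (m+n≤o⇒n≤o (suc p) (proj₁ oa)))
              (trans (cong (λ s → std (factor τ s (length z))) start) (proj₂ oa))))
    zK : 0 + length z ≤ K
    zK = maxBifixBelow-max τ (length τ ∸ 2) (length z) (subst (λ k → length z ≤ k ∸ 2) (sym |τ|≡) zl) bifix
  ...       | no zg = ⊥-elim (ne (trans (sym z≡∂τ) z≡τ∂))
    where
    |z| : length z ≡ suc n₂
    |z| = ≤-antisym lb (≰⇒> zg)
    z≡∂τ : z ≡ ∂τ
    z≡∂τ = ≼-same-length (≼⇒std ∂τ≼τ) ha (trans |z| (sym |∂τ|))
    z≡τ∂ : z ≡ τ∂
    z≡τ∂ = ≼-same-length (≼⇒std τ∂≼τ) hb (trans |z| (sym |τ∂|))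

  ≼∂τ∂⇒≼both : ∀ {z} → z ≼ ∂τ∂ → z ≼ ∂τ × z ≼ τ∂
  ≼∂τ∂⇒≼both h with ≼∂τ∂⁻ h
  ... | p , o , le = ≼∂τ⁺ p o (m≤n⇒m≤1+n le) , ≼τ∂⁺ (suc p) o (s≤s le)

  ≼ξ⇒≼both : ∀ {z} → z ≼ ξ → z ≼ ∂τ × z ≼ τ∂
  ≼ξ⇒≼both {z} (p , o) =
    ≼∂τ⁺ (suc (n₂ ∸ K) + p) (proj₁ (ξ-suffix⁻ o)) fitsEnd ,
    ≼τ∂⁺ p (proj₁ (ξ-prefix⁻ o)) (≤-trans (proj₂ (ξ-prefix⁻ o)) (m≤n⇒m≤1+n K≤n₂))
    where
    fitsEnd : suc (n₂ ∸ K) + p + length z ≤ suc n₂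
    fitsEnd = subst (_≤ suc n₂) (sym (+-assoc (suc (n₂ ∸ K)) p (length z)))
                (subst (suc (n₂ ∸ K) + (p + length z) ≤_) (cong suc (m∸n+n≡m K≤n₂))
                  (+-monoʳ-≤ (suc (n₂ ∸ K)) (proj₂ (ξ-suffix⁻ o))))

  ≺ξ⇒≼∂τ∂ : ∀ {z} → z ≼ ξ → z ≢ ξ → z ≼ ∂τ∂
  ≺ξ⇒≼∂τ∂ {z} (p , o) ne with ξ-prefix⁻ o
  ... | op , lp with p
  ...   | suc p′ = ≼∂τ∂⁺ p′ op (≤-trans (n≤1+n _) (≤-trans lp K≤n₂))
  ...   | zero with length z ≟ K
  ...     | yes e = ⊥-elim (ne (≼-same-length (≼⇒std ξ≼τ) (0 , o) (trans e (sym |ξ|))))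
  ...     | no zK = ≼∂τ∂⁺ (suc (n₂ ∸ K) + 0) (proj₁ (ξ-suffix⁻ o)) fitsInterior
    where
    fitsInterior : suc (n₂ ∸ K) + 0 + length z ≤ n₂
    fitsInterior = subst (_≤ n₂) (trans (+-suc (n₂ ∸ K) (length z)) (cong (λ t → suc (t + length z)) (sym (+-identityʳ (n₂ ∸ K)))))
                     (subst ((n₂ ∸ K) + suc (length z) ≤_) (m∸n+n≡m K≤n₂) (+-monoʳ-≤ (n₂ ∸ K) (≤∧≢⇒< lp zK)))

sum-of-zeros : ∀ {p q r s : ℤ} → p ℤ.+ q ≡ r ℤ.+ s → q ≡ + 0 → r ≡ + 0 → s ≡ + 0 → p ≡ + 0
sum-of-zeros {p} e refl refl refl = trans (sym (ℤP.+-identityʳ p)) e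

-- The Möbius sum over the patterns common to ∂τ and τ∂.  These form the
-- interval [σ,∂τ] when ∂τ = τ∂, and otherwise the union [σ,∂τ∂] ∪ [σ,ξ], whose
-- intersection is [σ,ξ] without ξ (if ξ ⋠ ∂τ∂); so the sum is 0 as soon as
-- μ(σ,ξ) = 0.
module CommonPatterns (σ τ : List ℕ) (n₂ : ℕ) (|τ|≡ : length τ ≡ suc (suc n₂)) where
  open Ends τ n₂ |τ|≡
  private
    U = properPatterns τ
    I? = inInterval? σ

    proper : ∀ k → k ≤ suc n₂ → k < length τ
    proper k le = subst (suc k ≤_) (sym |τ|≡) (s≤s le)

  common-sum-vanishes : σ ≢ ∂τ → (∂τ ≢ τ∂ → σ ≢ ∂τ∂) → (σ ≼ ξ → ¬ (ξ ≼ ∂τ∂) → μ σ ξ ≡ + 0)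
    → sumOn (λ z → I? ∂τ z ×-dec I? τ∂ z) U (μ σ) ≡ + 0
  common-sum-vanishes σ≢∂τ σ≢∂τ∂ μξ with ∂τ ≟ₗ τ∂
  ... | yes ∂τ≡τ∂ = trans (sumOn-cong _ (I? ∂τ) U (μ σ) (λ z _ r → proj₁ r) (λ z _ r → r , subst (λ w → InInterval σ w z) ∂τ≡τ∂ r))
                         (interval-sum-vanishes σ τ ∂τ ∂τ≼τ (proper _ (≤-reflexive |∂τ|)) σ≢∂τ)
  ... | no ∂τ≢τ∂ = trans (sumOn-cong _ _ U (μ σ) toUnion fromUnion) (union-vanishes (ξ ≼? ∂τ∂))
    where
    toUnion : ∀ z → z ∈ U → InInterval σ ∂τ z × InInterval σ τ∂ z → InInterval σ ∂τ∂ z ⊎ InInterval σ ξ z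
    toUnion z _ ((s , za) , (_ , zb)) = map-⊎ (s ,_) (s ,_) (≼both⇒≼∂τ∂⊎≼ξ ∂τ≢τ∂ za zb)
    fromUnion : ∀ z → z ∈ U → InInterval σ ∂τ∂ z ⊎ InInterval σ ξ z → InInterval σ ∂τ z × InInterval σ τ∂ z
    fromUnion z _ (inj₁ (s , zd)) = (s , proj₁ (≼∂τ∂⇒≼both zd)) , (s , proj₂ (≼∂τ∂⇒≼both zd))
    fromUnion z _ (inj₂ (s , zξ)) = (s , proj₁ (≼ξ⇒≼both zξ)) , (s , proj₂ (≼ξ⇒≼both zξ))

    interior-vanishes : sumOn (I? ∂τ∂) U (μ σ) ≡ + 0
    interior-vanishes = interval-sum-vanishes σ τ ∂τ∂ ∂τ∂≼τ (proper _ (≤-trans (≤-reflexive |∂τ∂|) (n≤1+n _))) (σ≢∂τ∂ ∂τ≢τ∂)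

    union-vanishes : Dec (ξ ≼ ∂τ∂) → sumOn (λ z → I? ∂τ∂ z ⊎-dec I? ξ z) U (μ σ) ≡ + 0
    union-vanishes (yes ξ≼∂τ∂) =
      trans (sumOn-cong _ (I? ∂τ∂) U (μ σ) (λ { z _ (inj₁ r) → r ; z _ (inj₂ (s , zξ)) → s , ≼-trans zξ ξ≼∂τ∂ }) (λ z _ → inj₁))
            interior-vanishes
    union-vanishes (no ξ⋠∂τ∂) =
      sum-of-zeros (sumOn-union (I? ∂τ∂) (I? ξ) U (μ σ)) intersection-vanishes interior-vanishes ξ-interval-vanishes
      where
      σ≢ξ : σ ≢ ξ
      σ≢ξ refl with trans (sym (μ-self σ)) (μξ (≼-refl (≼⇒std ξ≼τ)) ξ⋠∂τ∂)
      ... | ()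
      ξ-interval-vanishes : sumOn (I? ξ) U (μ σ) ≡ + 0
      ξ-interval-vanishes = interval-sum-vanishes σ τ ξ ξ≼τ (proper _ (≤-trans (≤-reflexive |ξ|) (≤-trans K≤n₂ (n≤1+n _)))) σ≢ξ
      top-vanishes : sumOn (λ z → I? ξ z ×-dec (z ≟ₗ ξ)) U (μ σ) ≡ + 0
      top-vanishes = sumOn-zero _ U (μ σ) λ { z _ ((s , _) , refl) → μξ s ξ⋠∂τ∂ }
      -- Σ_{[σ,ξ] ∖ {ξ}} = Σ_{[σ,ξ]} − μ(σ,ξ) = 0
      below-top-vanishes : sumOn (λ z → I? ξ z ×-dec ¬? (z ≟ₗ ξ)) U (μ σ) ≡ + 0
      below-top-vanishes = sum-of-zeros
        (trans (ℤP.+-comm (sumOn (λ z → I? ξ z ×-dec ¬? (z ≟ₗ ξ)) U (μ σ)) (sumOn (λ z → I? ξ z ×-dec (z ≟ₗ ξ)) U (μ σ)))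
          (trans (sym (sumOn-split (I? ξ) (_≟ₗ ξ) U (μ σ))) (sym (ℤP.+-identityʳ _))))
        top-vanishes ξ-interval-vanishes refl
      -- [σ,∂τ∂] ∩ [σ,ξ] = [σ,ξ] ∖ {ξ}, since ξ ⋠ ∂τ∂ while everything below ξ is
      intersection-vanishes : sumOn (λ z → I? ∂τ∂ z ×-dec I? ξ z) U (μ σ) ≡ + 0
      intersection-vanishes = trans
        (sumOn-cong _ _ U (μ σ) (λ z _ r → proj₂ r , λ { refl → ξ⋠∂τ∂ (proj₂ (proj₁ r)) })
                                (λ z _ r → (proj₁ (proj₁ r) , ≺ξ⇒≼∂τ∂ (proj₂ (proj₁ r)) (proj₂ r)) , proj₁ r))
        below-top-vanishes

-- Every z with
-- σ ≤ z < τ lies below ∂τ or τ∂, so by inclusion–exclusion μ(σ,τ) is minus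
-- the sum over the patterns common to ∂τ and τ∂ (the intervals [σ,∂τ],
-- [σ,τ∂] contributing 0).  Hence μ(σ,τ) = 0 provided μ(σ,ξ) = 0 whenever ξ is
-- a carrier element of [σ,τ].
μ-vanishes : ∀ σ τ n₂ (|τ|≡ : length τ ≡ suc (suc n₂)) → σ ≼ τ → length σ ≤ n₂
  → ((∂ τ) ≢ (τ ∂) → σ ≢ (∂ τ ∂))
  → (σ ≼ maxBifix τ → ¬ (maxBifix τ ≼ (∂ τ ∂)) → μ σ (maxBifix τ) ≡ + 0)
  → μ σ τ ≡ + 0
μ-vanishes σ τ n₂ |τ|≡ σ≼τ short σ≢∂τ∂ μξ = begin
  μ σ τ                                          ≡⟨ μ-unfold σ≢τ σ≼τ ⟩
  - sumOn (σ ≼?_) U (μ σ)                        ≡⟨ cong -_ (sumOn-cong _ _ U (μ σ) toEnds fromEnds) ⟩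
  - sumOn (λ z → I? ∂τ z ⊎-dec I? τ∂ z) U (μ σ)   ≡⟨ cong -_ ends-vanish ⟩
  + 0                                            ∎
  where
  open ≡-Reasoning
  open Ends τ n₂ |τ|≡ using (∂τ; τ∂; ∂τ≼τ; τ∂≼τ; |∂τ|; |τ∂|; proper⇒≼end)
  U = properPatterns τ
  I? = inInterval? σ
  shorter : ∀ w → length w ≡ suc n₂ → σ ≢ w
  shorter w |w| refl = 1+n≰n (subst (_≤ n₂) |w| short)
  σ≢τ : σ ≢ τ
  σ≢τ refl = 1+n≰n (≤-trans (n≤1+n _) (subst (_≤ n₂) |τ|≡ short))
  toEnds : ∀ z → z ∈ U → σ ≼ z → InInterval σ ∂τ z ⊎ InInterval σ τ∂ z
  toEnds z m s = map-⊎ (s ,_) (s ,_) (proper⇒≼end m)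
  fromEnds : ∀ z → z ∈ U → InInterval σ ∂τ z ⊎ InInterval σ τ∂ z → σ ≼ z
  fromEnds z _ (inj₁ r) = proj₁ r
  fromEnds z _ (inj₂ r) = proj₁ r
  proper : ∀ w → length w ≡ suc n₂ → length w < length τ
  proper w |w| = subst (_< length τ) (sym |w|) (subst (suc n₂ <_) (sym |τ|≡) ≤-refl)
  ends-vanish : sumOn (λ z → I? ∂τ z ⊎-dec I? τ∂ z) U (μ σ) ≡ + 0
  ends-vanish = sum-of-zeros (sumOn-union (I? ∂τ) (I? τ∂) U (μ σ))
    (CommonPatterns.common-sum-vanishes σ τ n₂ |τ|≡ (shorter ∂τ |∂τ|) σ≢∂τ∂ μξ)
    (interval-sum-vanishes σ τ ∂τ ∂τ≼τ (proper ∂τ |∂τ|) (shorter ∂τ |∂τ|))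
    (interval-sum-vanishes σ τ τ∂ τ∂≼τ (proper τ∂ |τ∂|) (shorter τ∂ |τ∂|))

at-All : ∀ {P : ℕ → Set} l i → All P l → i < length l → P (at l i)
at-All (x ∷ l) zero    (px ∷ _)  _       = px
at-All (x ∷ l) (suc i) (_ ∷ ps) (s≤s p) = at-All l i ps p

at-unique : ∀ l i j → Unique l → i < length l → j < length l → i ≢ j → at l i ≢ at l j
at-unique (x ∷ l) zero    zero    u                 _       _       ne = ⊥-elim (ne refl)
at-unique (x ∷ l) zero    (suc j) (a AllPairs.∷ u) _       (s≤s q) _  = at-All l j a q
at-unique (x ∷ l) (suc i) zero    (a AllPairs.∷ u) (s≤s p) _       _  = λ e → at-All l i a p (sym e)
at-unique (x ∷ l) (suc i) (suc j) (a AllPairs.∷ u) (s≤s p) (s≤s q) ne = at-unique l i j u p q (λ e → ne (cong suc e))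

std-perm : ∀ l → Unique l → IsPerm (std l)
std-perm l u = distinct , subst (λ n → All (λ a → 1 ≤ a × a ≤ n) (std l)) (sym (length-std l)) inRange
  where
  g = λ a → suc (rank a l)
  ∈⇒at : ∀ {a} l → a ∈ l → Σ ℕ λ i → i < length l × at l i ≡ a
  ∈⇒at (x ∷ l) (here refl) = 0 , s≤s z≤n , refl
  ∈⇒at (x ∷ l) (there m) with ∈⇒at l m
  ... | i , p , e = suc i , s≤s p , e
  rank-strict∈ : ∀ {a b} → a ∈ l → a < b → rank a l < rank b l
  rank-strict∈ m lt with ∈⇒at l m
  ... | i , p , refl = rank-strict l i p lt
  rank-< : ∀ {a} l → a ∈ l → rank a l < length l
  rank-< {a} (x ∷ l) (here refl) rewrite rank-no {x} {x} l (<-irrefl refl) = s≤s (LP.length-filter (_<? x) l)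
  rank-< {a} (x ∷ l) (there m) with x <? a
  ... | yes q rewrite rank-yes {x} {a} l q = s≤s (rank-< l m)
  ... | no q  rewrite rank-no {x} {a} l q = m≤n⇒m≤1+n (rank-< l m)
  g-injective : ∀ {a b} → a ∈ l → b ∈ l → a ≢ b → g a ≢ g b
  g-injective {a} {b} ma mb ne e with <-cmp a b
  ... | tri< lt _ _ = <-irrefl (suc-injective e) (rank-strict∈ ma lt)
  ... | tri≈ _ eq _ = ne eq
  ... | tri> _ _ gt = <-irrefl (suc-injective (sym e)) (rank-strict∈ mb gt)
  go : ∀ xs → (∀ {a} → a ∈ xs → a ∈ l) → Unique xs → Unique (map g xs)
  go [] _ _ = AllPairs.[]
  go (x ∷ xs) sub (a AllPairs.∷ u) =
    AllP.map⁺ (All.tabulate λ {y} my → g-injective (sub (here refl)) (sub (there my)) (All.lookup a my))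
    AllPairs.∷ go xs (λ m → sub (there m)) u
  distinct : Unique (std l)
  distinct = go l (λ m → m) u
  inRange : All (λ a → 1 ≤ a × a ≤ length l) (std l)
  inRange = AllP.map⁺ (All.tabulate λ m → s≤s z≤n , rank-< l m)

pattern-of-pattern : ∀ τ s k p c → s + k ≤ length τ → p + c ≤ k
  → std (factor (std (factor τ s k)) p c) ≡ std (factor τ (s + p) c)
pattern-of-pattern τ s k p c sk pc = subst (λ t → std (factor (std (factor τ s k)) p t) ≡ z) |z| (proj₂ inner)
  where
  fits : s + p + c ≤ length τ
  fits = ≤-trans (subst (_≤ s + k) (sym (+-assoc s p c)) (+-monoʳ-≤ s pc)) sk
  z = std (factor τ (s + p) c)
  |z| : length z ≡ c
  |z| = length-factorPattern τ (s + p) c fits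
  occurs : OccursAt z τ (s + p)
  occurs = subst (λ t → s + p + t ≤ length τ) (sym |z|) fits , cong (λ t → std (factor τ (s + p) t)) |z|
  inner = occurrence-in-factor⁺ τ s k sk (subst (λ t → p + t ≤ k) (sym |z|) pc) occurs

-- ξ inherits from τ everything the hypotheses of the proposition are about:
-- it is a permutation, its short bifix patterns are those of τ, and (if σ ≤ ξ)
-- its tails with respect to σ have the same lengths as those of τ.
module MaxBifixInherits (τ : List ℕ) (n₂ : ℕ) (|τ|≡ : length τ ≡ suc (suc n₂)) where
  open Ends τ n₂ |τ|≡

  K≤|τ| : K ≤ length τ
  K≤|τ| = ≤-trans (m≤n+m K c) (≤-reflexive c+K≡)

  prefix-inherited : ∀ j → j ≤ K → prefixPat j ξ ≡ prefixPat j τ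
  prefix-inherited j le = pattern-of-pattern τ 0 K 0 j fitsPrefix le

  suffix-inherited : ∀ j → j ≤ K → suffixPat j ξ ≡ suffixPat j τ
  suffix-inherited j le = begin
    suffixPat j ξ                              ≡⟨ suffixPat≡ ξ j (subst (j ≤_) (sym |ξ|) le) ⟩
    std (factor ξ (length ξ ∸ j) j)            ≡⟨ cong (λ t → std (factor ξ (t ∸ j) j)) |ξ| ⟩
    std (factor ξ (K ∸ j) j)                   ≡⟨ cong (λ w → std (factor w (K ∸ j) j)) ξ≡suffix ⟩
    std (factor (std (factor τ c K)) (K ∸ j) j) ≡⟨ pattern-of-pattern τ c K (K ∸ j) j fitsSuffix (≤-reflexive (m∸n+n≡m le)) ⟩
    std (factor τ (c + (K ∸ j)) j)             ≡⟨ cong (λ t → std (factor τ t j)) start ⟩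
    std (factor τ (length τ ∸ j) j)            ≡⟨ suffixPat≡ τ j (≤-trans le K≤|τ|) ⟨
    suffixPat j τ                              ∎
    where
    open ≡-Reasoning
    start : c + (K ∸ j) ≡ length τ ∸ j
    start = trans (sym (+-∸-assoc c le)) (cong (_∸ j) c+K≡)

  bifix-inherited : ∀ j β → IsBifixPat j ξ β → IsBifixPat j τ β
  bifix-inherited j β (le , pe , se) =
    ≤-trans jK K≤|τ| , trans (sym (prefix-inherited j jK)) pe , trans (sym (suffix-inherited j jK)) se
    where
    jK : j ≤ K
    jK = subst (j ≤_) |ξ| le

  perm-inherited : Unique τ → IsPerm ξ
  perm-inherited u = std-perm (take K τ) (Unique.take⁺ K u)

  maxBifix-carrier : ∀ {σ} → Unique τ → σ ≼ ξ → ¬ (ξ ≼ ∂τ∂) → Carrier σ τ ξ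
  maxBifix-carrier u σ≼ξ ξ⋠∂τ∂ =
    perm-inherited u , σ≼ξ , ξ≼τ , (proj₁ below , shorter |∂τ|) , (proj₂ below , shorter |τ∂|) , ξ⋠∂τ∂
    where
    below = ≼ξ⇒≼both (≼-refl (≼⇒std ξ≼τ))
    shorter : ∀ {w} → length w ≡ suc n₂ → ξ ≢ w
    shorter |w| e = 1+n≰n (subst (_≤ n₂) (trans (cong length e) |w|) |ξ|≤n₂)

  module _ {σ : List ℕ} (σ≼ξ : σ ≼ ξ) where
    private
      p₀ = proj₁ σ≼ξ
      o₀ = proj₂ σ≼ξ

    -- The leftmost occurrence of σ in τ lies in the prefix window of ξ, the
    -- rightmost one in its suffix window, so the tails keep their lengths.
    leftTail-inherited : ∀ {l} → LeftTail σ τ l → LeftTail σ ξ l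
    leftTail-inherited {l} (ol , leftmost) = ξ-prefix⁺ fits ol , λ j oj → leftmost j (proj₁ (ξ-prefix⁻ oj))
      where
      fits : l + length σ ≤ K
      fits = ≤-trans (+-monoˡ-≤ (length σ) (leftmost p₀ (proj₁ (ξ-prefix⁻ o₀)))) (proj₂ (ξ-prefix⁻ o₀))

    rightTail-inherited : ∀ {r} → RightTail σ τ r → RightTail σ ξ r
    rightTail-inherited {r} (i₀ , oi₀ , e₀ , rightmost) = i₀ ∸ c , ξ-suffix⁺ fits shifted , trans ends (sym |ξ|) , rightmost′
      where
      m = length σ
      c≤i₀ : c ≤ i₀
      c≤i₀ = ≤-trans (m≤m+n c p₀) (rightmost (c + p₀) (proj₁ (ξ-suffix⁻ o₀)))
      c+i : c + (i₀ ∸ c) ≡ i₀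
      c+i = m+[n∸m]≡n c≤i₀
      shifted : OccursAt σ τ (c + (i₀ ∸ c))
      shifted = subst (OccursAt σ τ) (sym c+i) oi₀
      ends : i₀ ∸ c + m + r ≡ K
      ends = +-cancelˡ-≡ c _ _ (begin
        c + (i₀ ∸ c + m + r)    ≡⟨ +-assoc c (i₀ ∸ c + m) r ⟨
        c + (i₀ ∸ c + m) + r    ≡⟨ cong (_+ r) (+-assoc c (i₀ ∸ c) m) ⟨
        c + (i₀ ∸ c) + m + r    ≡⟨ cong (λ t → t + m + r) c+i ⟩
        i₀ + m + r              ≡⟨ e₀ ⟩
        length τ                ≡⟨ c+K≡ ⟨
        c + K                   ∎)
        where open ≡-Reasoning
      fits : i₀ ∸ c + m ≤ K
      fits = subst (i₀ ∸ c + m ≤_) ends (m≤m+n (i₀ ∸ c + m) r)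
      rightmost′ : ∀ i′ → OccursAt σ ξ i′ → i′ ≤ i₀ ∸ c
      rightmost′ i′ o = +-cancelˡ-≤ c i′ (i₀ ∸ c) (subst (c + i′ ≤_) (sym c+i) (rightmost (c + i′) (proj₁ (ξ-suffix⁻ o))))

Ascending : List ℕ → Set
Ascending l = ∀ i → suc i < length l → at l i < at l (suc i)

Descending : List ℕ → Set
Descending l = ∀ i → suc i < length l → at l (suc i) < at l i

-- An ascending list has the identity as standard form; a descending one the
-- decreasing permutation.  (The i-th letter has rank i, resp. |l| − 1 − i.)
module _ where
  private
    rank-none : ∀ a l → (∀ j → j < length l → ¬ at l j < a) → rank a l ≡ 0
    rank-none a []      h = refl
    rank-none a (x ∷ l) h rewrite rank-no {x} {a} l (h 0 (s≤s z≤n)) = rank-none a l (λ j p → h (suc j) (s≤s p))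

    rank-all : ∀ a l → (∀ j → j < length l → at l j < a) → rank a l ≡ length l
    rank-all a []      h = refl
    rank-all a (x ∷ l) h rewrite rank-yes {x} {a} l (h 0 (s≤s z≤n)) = cong suc (rank-all a l (λ j p → h (suc j) (s≤s p)))

    Increasing′ Decreasing′ : List ℕ → Set
    Increasing′ l = ∀ i j → i < j → j < length l → at l i < at l j
    Decreasing′ l = ∀ i j → i < j → j < length l → at l j < at l i

    ascending⇒increasing : ∀ l → Ascending l → Increasing′ l
    ascending⇒increasing l h i (suc j) (s≤s i≤j) q with i ≟ j
    ... | yes refl = h i q
    ... | no ne    = <-trans (ascending⇒increasing l h i j (≤∧≢⇒< i≤j ne) (<⇒≤ q)) (h j q)

    descending⇒decreasing : ∀ l → Descending l → Decreasing′ l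
    descending⇒decreasing l h i (suc j) (s≤s i≤j) q with i ≟ j
    ... | yes refl = h i q
    ... | no ne    = <-trans (h j q) (descending⇒decreasing l h i j (≤∧≢⇒< i≤j ne) (<⇒≤ q))

    rank-increasing : ∀ l i → Increasing′ l → i < length l → rank (at l i) l ≡ i
    rank-increasing (x ∷ l) zero h _ rewrite rank-no {x} {x} l (<-irrefl refl) =
      rank-none x l λ j p q → <-irrefl refl (<-trans q (h 0 (suc j) (s≤s z≤n) (s≤s p)))
    rank-increasing (x ∷ l) (suc i) h (s≤s p) rewrite rank-yes {x} {at l i} l (h 0 (suc i) (s≤s z≤n) (s≤s p)) =
      cong suc (rank-increasing l i (λ a b q r → h (suc a) (suc b) (s≤s q) (s≤s r)) p)

    rank-decreasing : ∀ l i → Decreasing′ l → i < length l → rank (at l i) l ≡ length l ∸ suc i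
    rank-decreasing (x ∷ l) zero h _ rewrite rank-no {x} {x} l (<-irrefl refl) =
      rank-all x l λ j p → h 0 (suc j) (s≤s z≤n) (s≤s p)
    rank-decreasing (x ∷ l) (suc i) h (s≤s p)
      rewrite rank-no {x} {at l i} l (λ q → <-irrefl refl (<-trans q (h 0 (suc i) (s≤s z≤n) (s≤s p)))) =
      rank-decreasing l i (λ a b q r → h (suc a) (suc b) (s≤s q) (s≤s r)) p

    at-applyUpTo : ∀ (f : ℕ → ℕ) n i → i < n → at (applyUpTo f n) i ≡ f i
    at-applyUpTo f (suc n) zero    _       = refl
    at-applyUpTo f (suc n) (suc i) (s≤s p) = at-applyUpTo (λ x → f (suc x)) n i p

    at-applyDownFrom : ∀ (f : ℕ → ℕ) n i → i < n → at (applyDownFrom f n) i ≡ f (n ∸ suc i)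
    at-applyDownFrom f (suc n) zero    _       = refl
    at-applyDownFrom f (suc n) (suc i) (s≤s p) = at-applyDownFrom f n i p

    incPerm≡ : ∀ n → incPerm n ≡ applyUpTo suc n
    incPerm≡ n = LP.map-applyUpTo (λ x → x) suc n

    decPerm≡ : ∀ n → reverse (incPerm n) ≡ applyDownFrom suc n
    decPerm≡ n = trans (sym (LP.reverse-map suc (upTo n))) (trans (cong (map suc) (LP.reverse-upTo n)) (LP.map-applyDownFrom (λ x → x) suc n))

  std-ascending : ∀ l → Ascending l → std l ≡ incPerm (length l)
  std-ascending l h = list-ext (std l) (incPerm (length l))
    (trans (length-std l) (sym (trans (cong length (incPerm≡ (length l))) (LP.length-applyUpTo suc (length l)))))
    λ j p → let p′ = subst (j <_) (length-std l) p in
      trans (at-std l j p′) (trans (cong suc (rank-increasing l j (ascending⇒increasing l h) p′))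
        (sym (trans (cong (λ v → at v j) (incPerm≡ (length l))) (at-applyUpTo suc (length l) j p′))))

  std-descending : ∀ l → Descending l → std l ≡ reverse (incPerm (length l))
  std-descending l h = list-ext (std l) (reverse (incPerm (length l)))
    (trans (length-std l) (sym (trans (cong length (decPerm≡ (length l))) (LP.length-applyDownFrom suc (length l)))))
    λ j p → let p′ = subst (j <_) (length-std l) p in
      trans (at-std l j p′) (trans (cong suc (rank-decreasing l j (descending⇒decreasing l h) p′))
        (sym (trans (cong (λ v → at v j) (decPerm≡ (length l))) (at-applyDownFrom suc (length l) j p′))))

std-monotone : ∀ l → Ascending l ⊎ Descending l → Monotone (std l)
std-monotone l (inj₁ h) = inj₁ (trans (std-ascending l h) (cong incPerm (sym (length-std l))))
std-monotone l (inj₂ h) = inj₂ (trans (std-descending l h) (cong (λ n → reverse (incPerm n)) (sym (length-std l))))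

-- Two overlapping occurrences of σ at consecutive positions p, p + 1 force the
-- window τ[p, p+|σ|] to be monotone: the ascent/descent between positions
-- p+k and p+k+1 is copied to p+k+1, p+k+2 via σ.
module ConsecutiveOccurrences {σ τ : List ℕ} {p : ℕ} (u : Unique τ) (m≥1 : 1 ≤ length σ)
                              (o₁ : OccursAt σ τ p) (o₂ : OccursAt σ τ (suc p)) where
  m = length σ

  Ascent : ℕ → Set
  Ascent k = at τ (p + k) < at τ (p + suc k)

  ascent-shift : ∀ k → suc k < m → (Ascent k → Ascent (suc k)) × (Ascent (suc k) → Ascent k)
  ascent-shift k q = (λ a → fromSecond (proj₂ viaSecond (proj₁ viaFirst a))) ,
                     (λ a → proj₂ viaFirst (proj₁ viaSecond (toSecond a)))
    where
    viaFirst = compare (occurrence⇒sameOrder {σ} {τ} {p} o₁) k (suc k) (<⇒≤ q) q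
    viaSecond = compare (occurrence⇒sameOrder {σ} {τ} {suc p} o₂) k (suc k) (<⇒≤ q) q
    toSecond : Ascent (suc k) → at τ (suc p + k) < at τ (suc p + suc k)
    toSecond a rewrite sym (+-suc p k) | sym (+-suc p (suc k)) = a
    fromSecond : at τ (suc p + k) < at τ (suc p + suc k) → Ascent (suc k)
    fromSecond a rewrite sym (+-suc p k) | sym (+-suc p (suc k)) = a

  all-ascents : Ascent 0 → ∀ k → k < m → Ascent k
  all-ascents a zero    _ = a
  all-ascents a (suc k) q = proj₁ (ascent-shift k q) (all-ascents a k (<⇒≤ q))

  no-ascents : ¬ Ascent 0 → ∀ k → k < m → ¬ Ascent k
  no-ascents a zero    _ = a
  no-ascents a (suc k) q = λ x → no-ascents a k (<⇒≤ q) (proj₂ (ascent-shift k q) x)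

  window = factor τ p (suc m)

  private
    fits : p + suc m ≤ length τ
    fits = subst (_≤ length τ) (sym (+-suc p m)) (proj₁ o₂)
    |window| : length window ≡ suc m
    |window| = length-factor τ p (suc m) fits
    inside : ∀ k → k < suc m → p + k < length τ
    inside k q = <-≤-trans (+-monoʳ-< p q) fits

  window-ascending : Ascent 0 → Ascending window
  window-ascending a i q = ascent-at (subst (suc i <_) |window| q)
    where
    ascent-at : suc i < suc m → at window i < at window (suc i)
    ascent-at q′ rewrite at-factor τ p (suc m) i (<⇒≤ q′) | at-factor τ p (suc m) (suc i) q′ =
      all-ascents a i (s≤s⁻¹ q′)

  window-descending : ¬ Ascent 0 → Descending window
  window-descending a i q = descent-at (subst (suc i <_) |window| q)
    where
    descent : suc i < suc m → at τ (p + suc i) < at τ (p + i)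
    descent q′ with <-cmp (at τ (p + i)) (at τ (p + suc i))
    ... | tri< lt _ _ = ⊥-elim (no-ascents a i (s≤s⁻¹ q′) lt)
    ... | tri≈ _ eq _ = ⊥-elim (at-unique τ (p + i) (p + suc i) u (inside i (<⇒≤ q′)) (inside (suc i) q′)
                           (λ e → <-irrefl (+-cancelˡ-≡ p i (suc i) e) (n<1+n i)) eq)
    ... | tri> _ _ gt = gt
    descent-at : suc i < suc m → at window (suc i) < at window i
    descent-at q′ rewrite at-factor τ p (suc m) i (<⇒≤ q′) | at-factor τ p (suc m) (suc i) q′ = descent q′

  window-up : Ascent 0 → std window ≡ incPerm (suc m)
  window-up a = trans (std-ascending window (window-ascending a)) (cong incPerm |window|)

  window-down : ¬ Ascent 0 → std window ≡ reverse (incPerm (suc m))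
  window-down a = trans (std-descending window (window-descending a)) (cong (λ n → reverse (incPerm n)) |window|)

  window-monotone : Monotone (std window)
  window-monotone with at τ (p + 0) <? at τ (p + 1)
  ... | yes a = std-monotone window (inj₁ (window-ascending a))
  ... | no a  = std-monotone window (inj₂ (window-descending a))

whole-bifix : ∀ {k} τ → length τ ≡ k → IsBifixPat k τ (std τ)
whole-bifix τ refl = ≤-refl , cong std (LP.take-all (length τ) τ ≤-refl) , cong (λ k → std (drop k τ)) (n∸n≡0 (length τ))

-- A permutation pattern abc with a < b > c or a > b < c is monotone
-- (reverse) alternating (its odd part ac and its even part b are monotone).
length3-alternating : ∀ τ → Unique τ → length τ ≡ 3
  → (at τ 0 < at τ 1 × ¬ at τ 1 < at τ 2) ⊎ (¬ at τ 0 < at τ 1 × at τ 1 < at τ 2)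
  → MonotoneAlternating (std τ) ⊎ MonotoneReverseAlternating (std τ)
length3-alternating τ@(x ∷ y ∷ z ∷ []) ((x≢y ∷ x≢z ∷ []) AllPairs.∷ ((y≢z ∷ []) AllPairs.∷ _)) refl = alternation
  where
  g = λ a → suc (rank a τ)
  compares = compare (std-sameOrder τ)
  0<3 : 0 < 3
  0<3 = s≤s z≤n
  1<3 : 1 < 3
  1<3 = s≤s (s≤s z≤n)
  2<3 : 2 < 3
  2<3 = s≤s (s≤s (s≤s z≤n))
  flip : ∀ {a b} → a ≢ b → ¬ a < b → b < a
  flip {a} {b} ne nlt with <-cmp a b
  ... | tri< lt _ _ = ⊥-elim (nlt lt)
  ... | tri≈ _ e _  = ⊥-elim (ne e)
  ... | tri> _ _ gt = gt
  odd : MonotoneSeq (g x ∷ g z ∷ [])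
  odd with <-cmp x z
  ... | tri< lt _ _ = inj₁ (proj₁ (compares 0 2 0<3 2<3) lt ∷ [ g z ])
  ... | tri≈ _ e _  = ⊥-elim (x≢z e)
  ... | tri> _ _ gt = inj₂ (proj₁ (compares 2 0 2<3 0<3) gt ∷ [ g z ])
  even : MonotoneSeq (g y ∷ [])
  even = inj₁ [ g y ]
  alternation : (x < y × ¬ y < z) ⊎ (¬ x < y × y < z) → MonotoneAlternating (std τ) ⊎ MonotoneReverseAlternating (std τ)
  alternation (inj₁ (up , notUp)) =
    inj₁ ((proj₁ (compares 0 1 0<3 1<3) up ∷ (proj₁ (compares 2 1 2<3 1<3) (flip y≢z notUp) ∷ [ g z ])) , odd , even)
  alternation (inj₂ (notUp , up)) =
    inj₂ ((proj₁ (compares 1 0 1<3 0<3) (flip x≢y notUp) ∷ (proj₁ (compares 1 2 1<3 2<3) up ∷ [ g z ])) , odd , even)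

zigzag-bifix : ∀ (σ τ : List ℕ) → Unique τ → length τ ≡ suc (suc (length σ)) → 1 ≤ length σ → ¬ (1 < length σ)
  → (at τ 0 < at τ 1 × ¬ at τ 1 < at τ 2) ⊎ (¬ at τ 0 < at τ 1 × at τ 1 < at τ 2)
  → ∃ λ β → IsBifixPat (suc (suc (length σ))) τ β × (MonotoneAlternating β ⊎ MonotoneReverseAlternating β)
zigzag-bifix σ τ u |τ|≡ m≥1 m≯1 zigzag =
  std τ , whole-bifix τ |τ|≡ , length3-alternating τ u |τ|≡3 zigzag
  where
  |τ|≡3 : length τ ≡ 3
  |τ|≡3 = trans |τ|≡ (cong (λ t → suc (suc t)) (≤-antisym (≮⇒≥ m≯1) m≥1))

-- If |τ| = |σ| + 2 and σ occurs at positions 0, 1 and 2 of τ, then ∂τ = τ∂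
-- (both are the same monotone pattern), unless |σ| = 1 and τ zigzags, in
-- which case τ is a monotone (reverse) alternating bifix pattern of itself.
three-occurrences : ∀ {σ τ} → Unique τ → 1 ≤ length σ → (|τ|≡ : length τ ≡ suc (suc (length σ)))
  → OccursAt σ τ 0 → OccursAt σ τ 1 → OccursAt σ τ 2
  → (∂ τ) ≡ (τ ∂)
    ⊎ ∃ λ β → IsBifixPat (suc (suc (length σ))) τ β × (MonotoneAlternating β ⊎ MonotoneReverseAlternating β)
three-occurrences {σ} {τ} u m≥1 |τ|≡ o₀ o₁ o₂ with at τ 0 <? at τ 1 | at τ 1 <? at τ 2
... | yes a₀ | yes a₁ = inj₁ (trans ∂τ≡ (trans (Second.window-up a₁) (sym (trans τ∂≡ (First.window-up a₀)))))
  where open Ends τ (length σ) |τ|≡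
        module First = ConsecutiveOccurrences {σ} {τ} {0} u m≥1 o₀ o₁
        module Second = ConsecutiveOccurrences {σ} {τ} {1} u m≥1 o₁ o₂
... | no a₀  | no a₁  = inj₁ (trans ∂τ≡ (trans (Second.window-down a₁) (sym (trans τ∂≡ (First.window-down a₀)))))
  where open Ends τ (length σ) |τ|≡
        module First = ConsecutiveOccurrences {σ} {τ} {0} u m≥1 o₀ o₁
        module Second = ConsecutiveOccurrences {σ} {τ} {1} u m≥1 o₁ o₂
... | yes a₀ | no a₁  = inj₂ (zigzag-bifix σ τ u |τ|≡ m≥1 (λ m>1 → a₁ (proj₁ (shift m>1) a₀)) (inj₁ (a₀ , a₁)))
  where shift = ConsecutiveOccurrences.ascent-shift {σ} {τ} {0} u m≥1 o₀ o₁ 0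
... | no a₀  | yes a₁ = inj₂ (zigzag-bifix σ τ u |τ|≡ m≥1 (λ m>1 → a₀ (proj₂ (shift m>1) a₁)) (inj₂ (a₀ , a₁)))
  where shift = ConsecutiveOccurrences.ascent-shift {σ} {τ} {0} u m≥1 o₀ o₁ 0

tails-fit : ∀ {σ τ l r} → LeftTail σ τ l → RightTail σ τ r → l + length σ + r ≤ length τ
tails-fit {σ} {τ} {l} {r} (_ , leftmost) (i₀ , o₀ , e₀ , _) =
  subst (l + length σ + r ≤_) e₀ (+-monoˡ-≤ r (+-monoˡ-≤ (length σ) (leftmost i₀ o₀)))

rightmost-occurrence : ∀ {σ τ} k → RightTail σ τ 0 → length τ ≡ k + length σ → OccursAt σ τ k
rightmost-occurrence {σ} {τ} k (i₀ , o₀ , e₀ , _) e =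
  subst (OccursAt σ τ) (+-cancelʳ-≡ (length σ) i₀ k (trans (sym (+-identityʳ _)) (trans e₀ e))) o₀

longer-by-two : ∀ {m n} → suc (suc m) ≤ n → Σ ℕ λ n₂ → n ≡ suc (suc n₂) × m ≤ n₂
longer-by-two {n = suc (suc n₂)} (s≤s (s≤s le)) = n₂ , refl , le

length-≢ : ∀ {x y : List ℕ} → length x ≢ length y → x ≢ y
length-≢ ne e = ne (cong length e)

-- If |σ|
-- = |τ| − 2, τ is its own bifix pattern of length |σ| + 2; otherwise μ-vanishes
-- applies, and ξ satisfies the same hypotheses as τ.
vanishes-tails-1-1 : ∀ N σ τ → length τ < N → Unique τ → LeftTail σ τ 1 → RightTail σ τ 1
  → ¬ (∃ λ β → IsBifixPat (suc (suc (length σ))) τ β) → μ σ τ ≡ + 0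
vanishes-tails-1-1 (suc N) σ τ |τ|≤N u lt rt noBifix
  with longer-by-two (subst (λ t → suc t ≤ length τ) (+-comm (length σ) 1) (tails-fit lt rt))
... | n₂ , |τ|≡ , m≤n₂ with length σ ≟ n₂
...   | yes m≡n₂ = ⊥-elim (noBifix (std τ , whole-bifix τ (trans |τ|≡ (cong (λ t → suc (suc t)) (sym m≡n₂)))))
...   | no m≢n₂ = μ-vanishes σ τ n₂ |τ|≡ (1 , proj₁ lt) m≤n₂ (λ _ → length-≢ (λ e → m≢n₂ (trans e |∂τ∂|))) ξ-vanishes
  where
  open Ends τ n₂ |τ|≡
  open MaxBifixInherits τ n₂ |τ|≡
  ξ-vanishes : σ ≼ ξ → ¬ (ξ ≼ ∂τ∂) → μ σ ξ ≡ + 0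
  ξ-vanishes σ≼ξ _ = vanishes-tails-1-1 N σ ξ (ξ-below-bound |τ|≤N) (proj₁ (perm-inherited u))
    (leftTail-inherited σ≼ξ lt) (rightTail-inherited σ≼ξ rt) (λ { (β , b) → noBifix (β , bifix-inherited _ β b) })

whole-window : ∀ {k} τ → length τ ≡ k → factor τ 0 k ≡ τ
whole-window τ refl = LP.take-all (length τ) τ ≤-refl

std-window : ∀ τ p c → p + c ≤ length τ → std (factor (std τ) p c) ≡ std (factor τ p c)
std-window τ p c le = subst (λ t → std (factor (std t) p c) ≡ std (factor τ p c)) (whole-window τ refl)
  (pattern-of-pattern τ 0 (length τ) p c ≤-refl le)

monotone-suffix : ∀ {σ τ} → Unique τ → 1 ≤ length σ → length τ ≡ suc (suc (length σ))
  → OccursAt σ τ 1 → OccursAt σ τ 2 → Monotone (suffixPat (suc (length σ)) (std τ))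
monotone-suffix {σ} {τ} u m≥1 |τ|≡ o₁ o₂ =
  subst Monotone (sym lastWindow) (ConsecutiveOccurrences.window-monotone {σ} {τ} {1} u m≥1 o₁ o₂)
  where
  open ≡-Reasoning
  m = length σ
  |stdτ| : length (std τ) ≡ suc (suc m)
  |stdτ| = trans (length-std τ) |τ|≡
  lastWindow : suffixPat (suc m) (std τ) ≡ std (factor τ 1 (suc m))
  lastWindow = begin
    suffixPat (suc m) (std τ)                            ≡⟨ suffixPat≡ (std τ) (suc m) (subst (suc m ≤_) (sym |stdτ|) (n≤1+n _)) ⟩
    std (factor (std τ) (length (std τ) ∸ suc m) (suc m)) ≡⟨ cong (λ t → std (factor (std τ) (t ∸ suc m) (suc m))) |stdτ| ⟩
    std (factor (std τ) (suc m ∸ m) (suc m))             ≡⟨ cong (λ t → std (factor (std τ) t (suc m))) (m+n∸n≡m 1 m) ⟩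
    std (factor (std τ) 1 (suc m))                       ≡⟨ std-window τ 1 (suc m) (≤-reflexive (sym |τ|≡)) ⟩
    std (factor τ 1 (suc m))                             ∎

-- The cases |τ| = |σ| + 1
-- and |τ| = |σ| + 2 are excluded by the bifix hypotheses (in the latter σ
-- occurs at 1 and 2); otherwise μ-vanishes applies and ξ inherits everything.
vanishes-tails-1-0 : ∀ N σ τ → length τ < N → Unique τ → 1 ≤ length σ → LeftTail σ τ 1 → RightTail σ τ 0
  → ¬ (∃ λ β → IsBifixPat (suc (length σ)) τ β)
  → ¬ (∃ λ β → IsBifixPat (suc (suc (length σ))) τ β × Monotone (suffixPat (suc (length σ)) β))
  → μ σ τ ≡ + 0
vanishes-tails-1-0 (suc N) σ τ |τ|≤N u m≥1 lt rt noBifix noMonotoneSuffix with length τ ≟ suc (length σ)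
... | yes |τ|≡ = ⊥-elim (noBifix (std τ , whole-bifix τ |τ|≡))
... | no |τ|≢ with longer-by-two (≤∧≢⇒< (subst (_≤ length τ) (cong suc (+-identityʳ (length σ))) (tails-fit lt rt))
                                      (λ e → |τ|≢ (sym e)))
...   | n₂ , |τ|≡ , m≤n₂ with length σ ≟ n₂
...     | yes m≡n₂ = ⊥-elim (noMonotoneSuffix (std τ , whole-bifix τ |τ|≡m+2 ,
                       monotone-suffix u m≥1 |τ|≡m+2 (proj₁ lt) (rightmost-occurrence 2 rt |τ|≡m+2)))
  where |τ|≡m+2 = trans |τ|≡ (cong (λ t → suc (suc t)) (sym m≡n₂))
...     | no m≢n₂ = μ-vanishes σ τ n₂ |τ|≡ (1 , proj₁ lt) m≤n₂ (λ _ → length-≢ (λ e → m≢n₂ (trans e |∂τ∂|))) ξ-vanishes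
  where
  open Ends τ n₂ |τ|≡
  open MaxBifixInherits τ n₂ |τ|≡
  ξ-vanishes : σ ≼ ξ → ¬ (ξ ≼ ∂τ∂) → μ σ ξ ≡ + 0
  ξ-vanishes σ≼ξ _ = vanishes-tails-1-0 N σ ξ (ξ-below-bound |τ|≤N) (proj₁ (perm-inherited u)) m≥1
    (leftTail-inherited σ≼ξ lt) (rightTail-inherited σ≼ξ rt)
    (λ { (β , b) → noBifix (β , bifix-inherited _ β b) })
    (λ { (β , b , mono) → noMonotoneSuffix (β , bifix-inherited _ β b , mono) })

BifixWith : ℕ → List ℕ → (List ℕ → Set) → Set
BifixWith k τ P = ∃ λ β → IsBifixPat k τ β × P β

MonotoneAlternatingEither : List ℕ → Set
MonotoneAlternatingEither β = MonotoneAlternating β ⊎ MonotoneReverseAlternating β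

-- When |τ| = |σ| ≥ 1: either σ = τ, which is then the socle of [σ,τ] (no
-- carrier element fits into the shorter ∂σ), or μ(σ,τ) = 0 because no
-- pattern lies strictly between σ and τ.
same-length-vanishes : ∀ {σ τ} → σ ≼ τ → length τ ≡ length σ → 1 ≤ length σ → ¬ IsSocle σ τ σ → μ σ τ ≡ + 0
same-length-vanishes {σ} {τ} σ≼τ |τ|≡ m≥1 noSocle = byEquality (σ ≟ₗ τ)
  where
  |∂σ| : length (∂ σ) ≡ length σ ∸ 1
  |∂σ| = trans (length-std (drop 1 σ)) (LP.length-drop 1 σ)
  noCarrier : ∀ ξ → ¬ Carrier σ σ ξ
  noCarrier ξ (_ , σ≼ξ , _ , (ξ≼∂σ , _) , _) =
    <⇒≱ (∸-monoʳ-< {length σ} (s≤s z≤n) m≥1) (subst (length σ ≤_) |∂σ| (≤-trans (≼-length σ≼ξ) (≼-length ξ≼∂σ)))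
  byEquality : Dec (σ ≡ τ) → μ σ τ ≡ + 0
  byEquality (yes σ≡τ) = ⊥-elim (noSocle (subst (λ t → IsSocle σ t σ) σ≡τ (stop noCarrier)))
  byEquality (no σ≢τ) = trans (μ-unfold σ≢τ σ≼τ) (cong -_ (sumOn-zero (σ ≼?_) (properPatterns τ) (μ σ) λ z m σ≼z →
    ⊥-elim (<⇒≱ (subst (length z <_) |τ|≡ (proj₂ (properPattern⁻ {z} {τ} m))) (≼-length σ≼z))))

-- In case x = 0 with |τ| = n₂ + 2: σ ≠ ∂τ∂ unless ∂τ = τ∂.  Otherwise |σ| = n₂
-- and σ would occur at positions 0, 1, 2 of τ, which forces ∂τ = τ∂ or a
-- monotone (reverse) alternating bifix pattern of length |σ| + 2.
interior-differs : ∀ {σ τ} n₂ (|τ|≡ : length τ ≡ suc (suc n₂)) → Unique τ → 1 ≤ length σ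
  → LeftTail σ τ 0 → RightTail σ τ 0 → ¬ BifixWith (suc (suc (length σ))) τ MonotoneAlternatingEither
  → (∂ τ) ≢ (τ ∂) → σ ≢ (∂ τ ∂)
interior-differs {σ} {τ} n₂ |τ|≡ u m≥1 lt rt noAlternating ∂τ≢τ∂ σ≡∂τ∂
  with three-occurrences u m≥1 |τ|≡m+2 (proj₁ lt) o₁ (rightmost-occurrence 2 rt |τ|≡m+2)
  where
  open Ends τ n₂ |τ|≡ using (∂τ∂-occurrence; |∂τ∂|)
  |τ|≡m+2 = trans |τ|≡ (cong (λ t → suc (suc t)) (sym (trans (cong length σ≡∂τ∂) |∂τ∂|)))
  o₁ = subst (λ w → OccursAt w τ 1) (sym σ≡∂τ∂) ∂τ∂-occurrence
... | inj₁ ∂τ≡τ∂  = ∂τ≢τ∂ ∂τ≡τ∂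
... | inj₂ bifix = noAlternating bifix

-- Case x = 0 of the proposition, by induction on |τ|.  |τ| = |σ| is the socle
-- case, |τ| = |σ| + 1 gives a monotone bifix pattern (σ occurs at 0 and 1);
-- otherwise μ-vanishes applies, and if ξ is a carrier element, [σ,ξ] inherits
-- the hypotheses (its socle is that of [σ,τ]).
vanishes-tails-0-0 : ∀ N σ τ → length τ < N → Unique τ → 1 ≤ length σ → LeftTail σ τ 0 → RightTail σ τ 0
  → ¬ IsSocle σ τ σ
  → ¬ BifixWith (suc (length σ)) τ Monotone
  → ¬ BifixWith (suc (suc (length σ))) τ MonotoneAlternatingEither
  → μ σ τ ≡ + 0
vanishes-tails-0-0 (suc N) σ τ |τ|≤N u m≥1 lt rt noSocle noMonotone noAlternating with length τ ≟ length σ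
... | yes |τ|≡ = same-length-vanishes (0 , proj₁ lt) |τ|≡ m≥1 noSocle
... | no |τ|≢m with length τ ≟ suc (length σ)
...   | yes |τ|≡ = ⊥-elim (noMonotone (std τ , whole-bifix τ |τ|≡ ,
                     subst (Monotone ∘ std) (whole-window τ |τ|≡) (ConsecutiveOccurrences.window-monotone {σ} {τ} {0} u m≥1 (proj₁ lt) o₁)))
  where o₁ = rightmost-occurrence 1 rt |τ|≡
...   | no |τ|≢m+1 with longer-by-two (≤∧≢⇒< (≤∧≢⇒< (subst (_≤ length τ) (+-identityʳ (length σ)) (tails-fit lt rt))
                                                   (λ e → |τ|≢m (sym e))) (λ e → |τ|≢m+1 (sym e)))
...     | n₂ , |τ|≡ , m≤n₂ = μ-vanishes σ τ n₂ |τ|≡ (0 , proj₁ lt) m≤n₂ σ≢∂τ∂ ξ-vanishes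
  where
  open Ends τ n₂ |τ|≡
  open MaxBifixInherits τ n₂ |τ|≡
  σ≢∂τ∂ : ∂τ ≢ τ∂ → σ ≢ ∂τ∂
  σ≢∂τ∂ = interior-differs n₂ |τ|≡ u m≥1 lt rt noAlternating
  ξ-vanishes : σ ≼ ξ → ¬ (ξ ≼ ∂τ∂) → μ σ ξ ≡ + 0
  ξ-vanishes σ≼ξ ξ⋠∂τ∂ = vanishes-tails-0-0 N σ ξ (ξ-below-bound |τ|≤N) (proj₁ (perm-inherited u)) m≥1
    (leftTail-inherited σ≼ξ lt) (rightTail-inherited σ≼ξ rt)
    (λ socle → noSocle (next (maxBifix-carrier u σ≼ξ ξ⋠∂τ∂) socle))
    (λ { (β , b , mono) → noMonotone (β , bifix-inherited _ β b , mono) })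
    (λ { (β , b , alt) → noAlternating (β , bifix-inherited _ β b , alt) })

proposition3p9 : (σ τ : List ℕ) → IsPerm σ → IsPerm τ → 1 ≤ length σ → σ ≼ τ
    → (l r : ℕ) → LeftTail σ τ l → RightTail σ τ r → l ≤ 1 → r ≤ 1
    → ((l + r ≡ 0)
         → ¬ IsSocle σ τ σ
         → ¬ (∃ λ β → IsBifixPat (suc (length σ)) τ β × Monotone β)
         → ¬ (∃ λ β → IsBifixPat (suc (suc (length σ))) τ β
                      × (MonotoneAlternating β ⊎ MonotoneReverseAlternating β))
         → μ σ τ ≡ + 0)
      × ((l + r ≡ 1) → r ≡ 0
         → ¬ (∃ λ β → IsBifixPat (suc (length σ)) τ β)
         → ¬ (∃ λ β → IsBifixPat (suc (suc (length σ))) τ β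
                      × Monotone (suffixPat (suc (length σ)) β))
         → μ σ τ ≡ + 0)
      × ((l + r ≡ 2)
         → ¬ (∃ λ β → IsBifixPat (suc (suc (length σ))) τ β)
         → μ σ τ ≡ + 0)
proposition3p9 σ τ _ (distinct , _) m≥1 _ zero zero lt rt _ _ =
  (λ _ → vanishes-tails-0-0 (suc (length τ)) σ τ ≤-refl distinct m≥1 lt rt) , (λ ()) , (λ ())
proposition3p9 σ τ _ (distinct , _) m≥1 _ (suc zero) zero lt rt _ _ =
  (λ ()) , (λ _ _ → vanishes-tails-1-0 (suc (length τ)) σ τ ≤-refl distinct m≥1 lt rt) , (λ ())
proposition3p9 σ τ _ (distinct , _) m≥1 _ (suc zero) (suc zero) lt rt _ _ =
  (λ ()) , (λ ()) , (λ _ → vanishes-tails-1-1 (suc (length τ)) σ τ ≤-refl distinct lt rt)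
proposition3p9 σ τ _ _ _ _ zero (suc zero) _ _ _ _ = (λ ()) , (λ _ ()) , (λ ())
proposition3p9 σ τ _ _ _ _ (suc (suc _)) _ _ _ (s≤s ()) _
proposition3p9 σ τ _ _ _ _ _ (suc (suc _)) _ _ _ (s≤s ())
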